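{- Let $n$ be a positive integer divisible by $4$. Then the maximum number of turns of a Hamilton cycle of the grid graph $G(n,n)$ is exactly $n^2-n$.
   Context: $G(n,n)$ is the graph on cells $\{1,\dots,n\}^2$ with $(a,b),(c,d)$ adjacent iff $|a-c|+|b-d|=1$. A Hamilton cycle is a cycle through every cell. A turn of a cycle is a cell of the cycle whose two incident cycle edges are one horizontal (same second coordinate) and one vertical (same first coordinate). -}

module Defs where

open import Data.Nat using (ℕ; zero; suc; _+_; _*_; _<_; ∣_-_∣)
open import Data.Fin using (Fin; toℕ)
open import Data.Fin.Properties using (_≟_)
open import Data.Product using (_×_; _,_; proj₁; proj₂; ∃-syntax)
open import Data.Product.Properties using () 
open import Data.Sum using (_⊎_)
open import Data.List using (List; length; filter; upTo)
open import Relation.Binary.PropositionalEquality using (_≡_)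
open import Relation.Nullary using (Dec)
open import Relation.Nullary.Decidable using (_×-dec_; _⊎-dec_)

-- Cells of the n × n grid: (a , b) with a , b ∈ {0,…,n-1} (0-indexed version of {1,…,n}).
Cell : ℕ → Set
Cell n = Fin n × Fin n

Adjacent : ∀ {n} → Cell n → Cell n → Set
Adjacent (a , b) (c , d) = ∣ toℕ a - toℕ c ∣ + ∣ toℕ b - toℕ d ∣ ≡ 1

Horizontal : ∀ {n} → Cell n → Cell n → Set
Horizontal p q = proj₂ p ≡ proj₂ q

Vertical : ∀ {n} → Cell n → Cell n → Set
Vertical p q = proj₁ p ≡ proj₁ q

IsTurn : ∀ {n} → Cell n → Cell n → Cell n → Set
IsTurn p q r = (Horizontal p q × Vertical q r) ⊎ (Vertical p q × Horizontal q r)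

isTurn? : ∀ {n} (p q r : Cell n) → Dec (IsTurn p q r)
isTurn? p q r =
  ((proj₂ p ≟ proj₂ q) ×-dec (proj₁ q ≟ proj₁ r)) ⊎-dec
  ((proj₁ p ≟ proj₁ q) ×-dec (proj₂ q ≟ proj₂ r))

-- A Hamilton cycle of G(n,n), given as a cyclic enumeration of its cells:
-- cell i (read modulo n², i.e. the map is n²-periodic) is the i-th vertex
-- of the cycle; consecutive cells are adjacent, the cells cell 0 … cell (n²-1)
-- are pairwise distinct and every cell of the grid occurs among them.
record HamiltonCycle (n : ℕ) : Set where
  field
    cell       : ℕ → Cell n
    periodic   : ∀ i → cell (i + n * n) ≡ cell i
    adjacent   : ∀ i → Adjacent (cell i) (cell (suc i))
    injective  : ∀ i j → i < n * n → j < n * n → cell i ≡ cell j → i ≡ j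
    surjective : ∀ (x : Cell n) → ∃[ i ] (i < n * n × cell i ≡ x)

open HamiltonCycle public

-- Number of turns: the cycle's cells are cell 1, …, cell n² (= cell 0);
-- cell (suc i) has cycle-neighbours cell i and cell (suc (suc i)).
turns : ∀ {n} → HamiltonCycle n → ℕ
turns {n} H =
  length (filter (λ i → isTurn? (cell H i) (cell H (suc i)) (cell H (suc (suc i))))
                 (upTo (n * n)))

-- Write cells as (a , b) with column a and row b; a cell of the cycle is straight if it is no turn.
--
-- In column a let e b say whether the cycle uses the edge from (a , b - 1) to
-- (a , b), with e 0 = e n = false. As (a , b) has two cycle edges, it is a turn iff exactly one of
-- them is vertical, i.e. iff e b ≠ e (b + 1); since n is even, every column therefore holds an even
-- number of straight cells. So either each of the n / 2 column pairs {2k , 2k + 1} holds at least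
-- two straight cells, n in total, or some column pair consists of turns only. In a column of turns
-- e alternates, so the cycle contains all edges (a , 2l) - (a , 2l + 1). Applying this to the
-- transposed cycle as well, a turning column pair and a turning row pair would span a 4-cycle
-- inside the Hamilton cycle of length n² > 4.
--
-- For n = 4m the rows fall into m blocks of four. In block j the tour comes in at
-- (1 , 4j), zigzags through rows 4j, 4j + 1 out to column n - 3, snakes through the 2 × 4 rectangle
-- in columns n - 2, n - 1, zigzags back through rows 4j + 2, 4j + 3 and leaves at (1 , 4j + 3) for
-- the next block; after the last block it returns to (1 , 0) through columns 0 and 1, wiggling once
-- per block. Zigzags only turn, and every block has at most four straight cells. The visiting order
-- can be read off from the cell, so the tour is injective on a period and, by pigeonhole, covers
-- the grid.

module Submission where

open import Defs
open import Data.Nat using (ℕ; _*_; _∸_; _≤_; _<_)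
open import Data.Nat.Divisibility using (_∣_)
open import Data.Product using (_×_; Σ)
open import Relation.Binary.PropositionalEquality using (_≡_)

open import Data.Bool using (Bool; true; false; not; _∧_; _∨_; _xor_; if_then_else_; T)
open import Data.Bool.Properties
  using (not-distribˡ-xor; not-involutive; xor-assoc; xor-identityʳ; xor-comm;
         ∨-identityˡ; ∨-identityʳ; ∨-zeroʳ; ∨-comm; ¬-not; T-≡)
import Data.Bool.Properties as Bool
open import Data.Empty using (⊥; ⊥-elim)
open import Data.Fin using (Fin; toℕ; fromℕ<; combine; punchOut)
open import Data.Fin.Patterns using (0F; 1F; 2F; 3F; 4F; 5F; 6F; 7F)
open import Data.Fin.Properties
  using (toℕ-injective; toℕ-fromℕ<; toℕ<n; any?; injective⇒≤; punchOut-injective; combine-injective)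
  renaming (_≟_ to _≟ᶠ_)
open import Data.List using ([_]; _++_; length; filter; upTo)
open import Data.List.Properties using (upTo-∷ʳ; filter-++; length-++)
open import Data.Nat hiding (_≟_)
open import Data.Nat.DivMod
  using (_%_; _/_; m%n<n; m<n⇒m%n≡m; m≡m%n+[m/n]*n; %-distribˡ-+; [m+kn]%n≡m%n; m<n⇒m/n≡0; +-distrib-/-∣ʳ; m*n/n≡m)
open import Data.Nat.Divisibility using (divides; divides-refl)
open import Data.Nat.Properties
open import Algebra.Properties.CommutativeSemigroup +-commutativeSemigroup using (interchange)
open import Data.Nat.Tactic.RingSolver using (solve-∀)
open import Data.Product using (∃-syntax; _,_; proj₁; proj₂; swap)
open import Data.Product.Properties using (×-≡,≡→≡)
open import Data.Sum using (_⊎_; inj₁; inj₂)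
import Data.Sum as Sum
open import Data.Unit using (⊤; tt)
open import Function using (_∘_)
open import Function.Bundles using (Equivalence; mk⇔)
open import Relation.Binary.PropositionalEquality
  using (_≢_; refl; sym; trans; cong; cong₂; subst; module ≡-Reasoning)
open import Relation.Nullary using (Dec; yes; no; does; ¬_; ¬?; contradiction)
open import Relation.Nullary.Decidable using (dec-true; dec-false; does-⇔; _×-dec_; _⊎-dec_; decidable-stable)
open import Relation.Unary using (Decidable)

witness : ∀ {A : Set} (a? : Dec A) → does a? ≡ true → A
witness (yes a) _ = a

refute : ∀ {A : Set} (a? : Dec A) → does a? ≡ false → ¬ A
refute (no ¬a) _ = ¬a

∧-elim : ∀ {a b} → a ∧ b ≡ true → a ≡ true × b ≡ true
∧-elim {true} {true} _ = refl , refl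

not-true : ∀ {b} → not b ≡ true → b ≡ false
not-true {false} _ = refl

∧-false : ∀ {a b} → (a ≡ true → b ≡ true → ⊥) → a ∧ b ≡ false
∧-false {true}  {true}  both = ⊥-elim (both refl refl)
∧-false {true}  {false} _    = refl
∧-false {false}         _    = refl

bool-ext : ∀ {a b} → (a ≡ true → b ≡ true) → (b ≡ true → a ≡ true) → a ≡ b
bool-ext {true}         a⇒b _   = sym (a⇒b refl)
bool-ext {false} {true} _   b⇒a = b⇒a refl
bool-ext {false} {false} _  _   = refl

fromℕ-mod : ∀ {n} .{{_ : NonZero n}} → ℕ → Fin n
fromℕ-mod {n} b = fromℕ< (m%n<n b n)

toℕ-fromℕ-mod : ∀ {n} .{{_ : NonZero n}} {b} → b < n → toℕ (fromℕ-mod {n} b) ≡ b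
toℕ-fromℕ-mod {n} {b} b<n = trans (toℕ-fromℕ< (m%n<n b n)) (m<n⇒m%n≡m b<n)

module Counting where

  bit : Bool → ℕ
  bit true  = 1
  bit false = 0

  count : (ℕ → Bool) → ℕ → ℕ
  count f zero    = 0
  count f (suc N) = count f N + bit (f N)

  length-filter-upTo : ∀ {P : ℕ → Set} (P? : Decidable P) N →
                       length (filter P? (upTo N)) ≡ count (does ∘ P?) N
  length-filter-upTo P? zero    = refl
  length-filter-upTo P? (suc N) = begin
    length (filter P? (upTo (suc N)))                         ≡⟨ cong (length ∘ filter P?) (upTo-∷ʳ N) ⟨
    length (filter P? (upTo N ++ [ N ]))                      ≡⟨ cong length (filter-++ P? (upTo N) [ N ]) ⟩
    length (filter P? (upTo N) ++ filter P? [ N ])            ≡⟨ length-++ (filter P? (upTo N)) ⟩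
    length (filter P? (upTo N)) + length (filter P? [ N ])    ≡⟨ cong₂ _+_ (length-filter-upTo P? N) singleton ⟩
    count (does ∘ P?) N + bit (does (P? N))                   ∎
    where
    open ≡-Reasoning
    singleton : length (filter P? [ N ]) ≡ bit (does (P? N))
    singleton with does (P? N)
    ... | true  = refl
    ... | false = refl

  count-cong : ∀ {f g} N → (∀ i → i < N → f i ≡ g i) → count f N ≡ count g N
  count-cong zero    f≗g = refl
  count-cong (suc N) f≗g =
    cong₂ _+_ (count-cong N (λ i i<N → f≗g i (m<n⇒m<1+n i<N))) (cong bit (f≗g N ≤-refl))

  count-complement : ∀ (f : ℕ → Bool) N → count f N + count (not ∘ f) N ≡ N
  count-complement f zero    = refl
  count-complement f (suc N) = begin
    (count f N + bit (f N)) + (count (not ∘ f) N + bit (not (f N)))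
      ≡⟨ interchange (count f N) _ _ _ ⟩
    (count f N + count (not ∘ f) N) + (bit (f N) + bit (not (f N)))
      ≡⟨ cong₂ _+_ (count-complement f N) (bit-not (f N)) ⟩
    N + 1
      ≡⟨ +-comm N 1 ⟩
    suc N ∎
    where
    open ≡-Reasoning
    bit-not : ∀ b → bit b + bit (not b) ≡ 1
    bit-not true  = refl
    bit-not false = refl

  count-split : ∀ (f g : ℕ → Bool) N →
                count f N ≡ count (λ i → f i ∧ g i) N + count (λ i → f i ∧ not (g i)) N
  count-split f g zero    = refl
  count-split f g (suc N) = begin
    count f N + bit (f N)
      ≡⟨ cong₂ _+_ (count-split f g N) (bit-split (f N) (g N)) ⟩
    (count (λ i → f i ∧ g i) N + count (λ i → f i ∧ not (g i)) N) + (bit (f N ∧ g N) + bit (f N ∧ not (g N)))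
      ≡⟨ interchange (count (λ i → f i ∧ g i) N) _ _ _ ⟩
    count (λ i → f i ∧ g i) (suc N) + count (λ i → f i ∧ not (g i)) (suc N) ∎
    where
    open ≡-Reasoning
    bit-split : ∀ a b → bit a ≡ bit (a ∧ b) + bit (a ∧ not b)
    bit-split true  true  = refl
    bit-split true  false = refl
    bit-split false _     = refl

  count≡0 : ∀ {f} N → (∀ i → i < N → f i ≡ false) → count f N ≡ 0
  count≡0 zero    none = refl
  count≡0 {f} (suc N) none rewrite none N ≤-refl =
    trans (+-identityʳ _) (count≡0 N (λ i i<N → none i (m<n⇒m<1+n i<N)))

  count≤1 : ∀ {f} N → (∀ i j → i < N → j < N → f i ≡ true → f j ≡ true → i ≡ j) → count f N ≤ 1
  count≤1 zero    unique = z≤n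
  count≤1 {f} (suc N) unique with f N in fN
  ... | true  = ≤-reflexive (cong (_+ 1) (count≡0 N others-false))
    where
    others-false : ∀ i → i < N → f i ≡ false
    others-false i i<N with f i in fi
    ... | false = refl
    ... | true  = contradiction (unique i N (m<n⇒m<1+n i<N) ≤-refl fi fN) (<⇒≢ i<N)
  ... | false = ≤-trans (≤-reflexive (+-identityʳ _))
                        (count≤1 N (λ i j i<N j<N → unique i j (m<n⇒m<1+n i<N) (m<n⇒m<1+n j<N)))

  count≥1 : ∀ {f} N i → i < N → f i ≡ true → 1 ≤ count f N
  count≥1 {f} (suc N) i i<1+N fi with i ≟ N
  ... | yes refl rewrite fi = m≤n+m 1 (count f N)
  ... | no  i≢N  = ≤-trans (count≥1 N i (≤∧≢⇒< (s≤s⁻¹ i<1+N) i≢N) fi) (m≤m+n _ _)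

  count≥2 : ∀ {f} N i j → i < N → j < N → i ≢ j → f i ≡ true → f j ≡ true → 2 ≤ count f N
  count≥2 {f} N i j i<N j<N i≢j fi fj = begin
    2                                                                  ≤⟨ +-mono-≤ (count≥1 N i i<N at-i)
                                                                                           (count≥1 N j j<N at-j) ⟩
    count (λ k → f k ∧ is-i k) N + count (λ k → f k ∧ not (is-i k)) N  ≡⟨ count-split f is-i N ⟨
    count f N                                                          ∎
    where
    open ≤-Reasoning
    is-i : ℕ → Bool
    is-i k = does (k ≟ i)
    at-i : (f i ∧ is-i i) ≡ true
    at-i rewrite fi = dec-true (i ≟ i) refl
    at-j : (f j ∧ not (is-i j)) ≡ true
    at-j rewrite fj | dec-false (j ≟ i) (i≢j ∘ sym) = refl

  count≤-by-code : ∀ {f} N (code : ℕ → ℕ) M →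
    (∀ i → i < N → f i ≡ true → code i < M) →
    (∀ i j → i < N → j < N → f i ≡ true → f j ≡ true → code i ≡ code j → i ≡ j) →
    count f N ≤ M
  count≤-by-code {f} N code zero    bounded _ = ≤-reflexive (count≡0 N none)
    where
    none : ∀ i → i < N → f i ≡ false
    none i i<N with f i in fi
    ... | false = refl
    ... | true  = contradiction (bounded i i<N fi) n≮0
  count≤-by-code {f} N code (suc M) bounded injective = begin
    count f N                                                   ≡⟨ count-split f at-M N ⟩
    count (λ i → f i ∧ at-M i) N + count (λ i → f i ∧ not (at-M i)) N
      ≤⟨ +-mono-≤ (count≤1 N code-M-unique) (count≤-by-code N code M below-M injective-rest) ⟩
    suc M                                                       ∎
    where
    open ≤-Reasoning
    at-M : ℕ → Bool
    at-M i = does (code i ≟ M)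
    code-M-unique : ∀ i j → i < N → j < N → f i ∧ at-M i ≡ true → f j ∧ at-M j ≡ true → i ≡ j
    code-M-unique i j i<N j<N fi fj with ∧-elim fi | ∧-elim fj
    ... | fi′ , ci | fj′ , cj =
      injective i j i<N j<N fi′ fj′ (trans (witness (code i ≟ M) ci) (sym (witness (code j ≟ M) cj)))
    below-M : ∀ i → i < N → f i ∧ not (at-M i) ≡ true → code i < M
    below-M i i<N fi with ∧-elim fi
    ... | fi′ , ci = ≤∧≢⇒< (s≤s⁻¹ (bounded i i<N fi′))
                         (refute (code i ≟ M) (not-true ci))
    injective-rest : ∀ i j → i < N → j < N → f i ∧ not (at-M i) ≡ true → f j ∧ not (at-M j) ≡ true →
                     code i ≡ code j → i ≡ j
    injective-rest i j i<N j<N fi fj = injective i j i<N j<N (proj₁ (∧-elim fi)) (proj₁ (∧-elim fj))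

  LabelledPair : (ℕ → Bool) → ℕ → (ℕ → ℕ) → ℕ → Set
  LabelledPair f N label k =
    ∃[ u ] ∃[ v ] u < N × v < N × u ≢ v × f u ≡ true × f v ≡ true × label u ≡ k × label v ≡ k

  2*≤count-by-pairs : ∀ {f} N (label : ℕ → ℕ) K → (∀ k → k < K → LabelledPair f N label k) → 2 * K ≤ count f N
  2*≤count-by-pairs N label zero    pairs = z≤n
  2*≤count-by-pairs {f} N label (suc K) pairs = begin
    2 * suc K                                                         ≡⟨ *-suc 2 K ⟩
    2 + 2 * K                                                         ≤⟨ +-mono-≤ pair-K rest ⟩
    count (λ i → f i ∧ at-K i) N + count (λ i → f i ∧ not (at-K i)) N  ≡⟨ count-split f at-K N ⟨
    count f N                                                         ∎
    where
    open ≤-Reasoning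
    at-K : ℕ → Bool
    at-K i = does (label i ≟ K)
    pair-K : 2 ≤ count (λ i → f i ∧ at-K i) N
    pair-K with pairs K ≤-refl
    ... | u , v , u<N , v<N , u≢v , fu , fv , lu , lv = count≥2 N u v u<N v<N u≢v
      (trans (cong (_∧ at-K u) fu) (dec-true (label u ≟ K) lu))
      (trans (cong (_∧ at-K v) fv) (dec-true (label v ≟ K) lv))
    rest : 2 * K ≤ count (λ i → f i ∧ not (at-K i)) N
    rest = 2*≤count-by-pairs N label K λ k k<K → relabel k k<K (pairs k (m<n⇒m<1+n k<K))
      where
      relabel : ∀ k → k < K → LabelledPair f N label k → LabelledPair (λ i → f i ∧ not (at-K i)) N label k
      relabel k k<K (u , v , u<N , v<N , u≢v , fu , fv , lu , lv) =
        u , v , u<N , v<N , u≢v , off-K u fu lu , off-K v fv lv , lu , lv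
        where
        off-K : ∀ w → f w ≡ true → label w ≡ k → f w ∧ not (at-K w) ≡ true
        off-K w fw lw = trans (cong (_∧ not (at-K w)) fw)
                              (cong not (dec-false (label w ≟ K) (λ w≡K → <⇒≢ k<K (trans (sym lw) w≡K))))

  count-witness : ∀ {f} N → 1 ≤ count f N → ∃[ i ] i < N × f i ≡ true
  count-witness {f} (suc N) positive with f N in fN
  ... | true  = N , ≤-refl , fN
  ... | false with count-witness N (subst (1 ≤_) (+-identityʳ _) positive)
  ...   | i , i<N , fi = i , m<n⇒m<1+n i<N , fi

  another-witness : ∀ {f} N i → 2 ≤ count f N → ∃[ j ] j < N × j ≢ i × f j ≡ true
  another-witness {f} N i two with count-witness N rest-positive
    where
    is-i : ℕ → Bool
    is-i k = does (k ≟ i)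
    at-most-i : count (λ k → f k ∧ is-i k) N ≤ 1
    at-most-i = count≤1 N λ j k _ _ fj fk →
      trans (witness (j ≟ i) (proj₂ (∧-elim fj))) (sym (witness (k ≟ i) (proj₂ (∧-elim fk))))
    rest-positive : 1 ≤ count (λ k → f k ∧ not (is-i k)) N
    rest-positive = +-cancelˡ-≤ 1 _ _
      (≤-trans (≤-trans two (≤-reflexive (count-split f is-i N))) (+-monoˡ-≤ _ at-most-i))
  ... | j , j<N , fj with ∧-elim fj
  ...   | fj′ , j≢i = j , j<N , refute (j ≟ i) (not-true j≢i) , fj′

module Parity where

  open Counting

  isOdd : ℕ → Bool
  isOdd zero    = false
  isOdd (suc n) = not (isOdd n)

  isOdd-+ : ∀ m n → isOdd (m + n) ≡ isOdd m xor isOdd n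
  isOdd-+ zero    n = refl
  isOdd-+ (suc m) n = trans (cong not (isOdd-+ m n)) (not-distribˡ-xor (isOdd m) (isOdd n))

  isOdd-*2 : ∀ k → isOdd (k * 2) ≡ false
  isOdd-*2 zero    = refl
  isOdd-*2 (suc k) = trans (not-involutive (isOdd (k * 2))) (isOdd-*2 k)

  toggles : (ℕ → Bool) → ℕ → Bool
  toggles G b = G b xor G (suc b)

  xor-toggles : ∀ G N → G N ≡ G 0 xor isOdd (count (toggles G) N)
  xor-toggles G zero    = sym (xor-identityʳ (G 0))
  xor-toggles G (suc N) = begin
    G (suc N)                                                          ≡⟨ xor-cancel (G N) (G (suc N)) ⟨
    G N xor toggles G N                                                ≡⟨ cong (_xor toggles G N) (xor-toggles G N) ⟩
    (G 0 xor isOdd (count (toggles G) N)) xor toggles G N              ≡⟨ xor-assoc (G 0) _ _ ⟩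
    G 0 xor (isOdd (count (toggles G) N) xor toggles G N)              ≡⟨ cong (G 0 xor_) isOdd-count-step ⟨
    G 0 xor isOdd (count (toggles G) (suc N))                          ∎
    where
    open ≡-Reasoning
    isOdd-count-step : isOdd (count (toggles G) (suc N)) ≡ isOdd (count (toggles G) N) xor toggles G N
    isOdd-count-step with toggles G N
    ... | true  = isOdd-+ (count (toggles G) N) 1
    ... | false = isOdd-+ (count (toggles G) N) 0
    xor-cancel : ∀ a b → a xor (a xor b) ≡ b
    xor-cancel true  b = not-involutive b
    xor-cancel false b = refl

  alternating : ∀ (G : ℕ → Bool) K → G 0 ≡ false → (∀ b → b < K → toggles G b ≡ true) →
                ∀ b → b ≤ K → G b ≡ isOdd b
  alternating G K G0 all-toggle zero    _   = G0
  alternating G K G0 all-toggle (suc b) b<K =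
    trans (xor-true (all-toggle b b<K)) (cong not (alternating G K G0 all-toggle b (<⇒≤ b<K)))
    where
    xor-true : ∀ {a b} → a xor b ≡ true → b ≡ not a
    xor-true {true}  {false} _ = refl
    xor-true {false} {true}  _ = refl

  another-steady-step : ∀ (G : ℕ → Bool) n → isOdd n ≡ false → G 0 ≡ G n →
    ∀ b₀ → b₀ < n → toggles G b₀ ≡ false → ∃[ b₁ ] b₁ < n × b₁ ≢ b₀ × toggles G b₁ ≡ false
  another-steady-step G n n-even closed b₀ b₀<n steady-b₀
    with another-witness n b₀ two-steady
    where
    open ≡-Reasoning
    toggling steady : ℕ
    toggling = count (toggles G) n
    steady   = count (not ∘ toggles G) n
    toggling-even : isOdd toggling ≡ false
    toggling-even = xor-≡ˡ (trans closed (xor-toggles G n))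
      where
      xor-≡ˡ : ∀ {a b} → a ≡ a xor b → b ≡ false
      xor-≡ˡ {true}  {false} _ = refl
      xor-≡ˡ {false} {false} _ = refl
    steady-even : isOdd steady ≡ false
    steady-even = begin
      isOdd steady                        ≡⟨ cong (_xor isOdd steady) toggling-even ⟨
      isOdd toggling xor isOdd steady     ≡⟨ isOdd-+ toggling steady ⟨
      isOdd (toggling + steady)           ≡⟨ cong isOdd (count-complement (toggles G) n) ⟩
      isOdd n                             ≡⟨ n-even ⟩
      false                               ∎
    two-steady : 2 ≤ steady
    two-steady = even∧positive⇒≥2 steady-even (count≥1 n b₀ b₀<n (cong not steady-b₀))
      where
      even∧positive⇒≥2 : ∀ {k} → isOdd k ≡ false → 1 ≤ k → 2 ≤ k
      even∧positive⇒≥2 {suc (suc _)} _ _ = s≤s (s≤s z≤n)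
  ... | b₁ , b₁<n , b₁≢b₀ , steady-b₁ = b₁ , b₁<n , b₁≢b₀ , not-true steady-b₁

module Grid where

  vertical? horizontal? : ∀ {n} → Cell n → Cell n → Bool
  vertical?   p q = does (proj₁ p ≟ᶠ proj₁ q)
  horizontal? p q = does (proj₂ p ≟ᶠ proj₂ q)

  vertical?-sym : ∀ {n} (p q : Cell n) → vertical? p q ≡ vertical? q p
  vertical?-sym p q = does-⇔ (mk⇔ sym sym) (proj₁ p ≟ᶠ proj₁ q) (proj₁ q ≟ᶠ proj₁ p)

  Above : ∀ {n} → Cell n → Cell n → Set
  Above x y = proj₁ x ≡ proj₁ y × toℕ (proj₂ y) ≡ suc (toℕ (proj₂ x))

  above? : ∀ {n} (x y : Cell n) → Dec (Above x y)
  above? x y = (proj₁ x ≟ᶠ proj₁ y) ×-dec (toℕ (proj₂ y) ≟ suc (toℕ (proj₂ x)))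

  isAbove isBelow : ∀ {n} → Cell n → Cell n → Bool
  isAbove x y = does (above? x y)
  isBelow x y = does (above? y x)

  above-unique : ∀ {n} {x p s : Cell n} → Above x p → Above x s → p ≡ s
  above-unique (x≡p , p≡x+1) (x≡s , s≡x+1) =
    ×-≡,≡→≡ (trans (sym x≡p) x≡s , toℕ-injective (trans p≡x+1 (sym s≡x+1)))

  below-unique : ∀ {n} {x p s : Cell n} → Above p x → Above s x → p ≡ s
  below-unique (p≡x , x≡p+1) (s≡x , x≡s+1) =
    ×-≡,≡→≡ (trans p≡x (sym s≡x) , toℕ-injective (suc-injective (trans (sym x≡p+1) x≡s+1)))

  above-asym : ∀ {n} {x y : Cell n} → Above x y → ¬ Above y x
  above-asym {x = x} (_ , y≡x+1) (_ , x≡y+1) = <-irrefl x≡y+1+1 (m<n⇒m<1+n (n<1+n (toℕ (proj₂ x))))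
    where x≡y+1+1 = trans x≡y+1 (cong suc y≡x+1)

  adjacent-sym : ∀ {n} (p q : Cell n) → Adjacent p q → Adjacent q p
  adjacent-sym p q = trans (cong₂ _+_ (∣-∣-comm (toℕ (proj₁ q)) _) (∣-∣-comm (toℕ (proj₂ q)) _))

  adjacent-step : ∀ {n} (p q : Cell n) → Adjacent p q →
                  (Above p q ⊎ Above q p) ⊎ (proj₁ p ≢ proj₁ q × proj₂ p ≡ proj₂ q)
  adjacent-step p q adj with +≡1 (∣ toℕ (proj₁ p) - toℕ (proj₁ q) ∣) adj
    where
    +≡1 : ∀ a {b} → a + b ≡ 1 → (a ≡ 0 × b ≡ 1) ⊎ (a ≡ 1 × b ≡ 0)
    +≡1 zero          b≡1 = inj₁ (refl , b≡1)
    +≡1 (suc zero) {zero} _ = inj₂ (refl , refl)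
  ... | inj₁ (d₁≡0 , d₂≡1) =
    inj₁ (vertical-step (toℕ-injective (∣m-n∣≡0⇒m≡n d₁≡0)) (∣m-n∣≡1 _ _ d₂≡1))
    where
    ∣m-n∣≡1 : ∀ m k → ∣ m - k ∣ ≡ 1 → k ≡ suc m ⊎ m ≡ suc k
    ∣m-n∣≡1 zero    (suc k) e = inj₁ e
    ∣m-n∣≡1 (suc m) zero    e = inj₂ e
    ∣m-n∣≡1 (suc m) (suc k) e = Sum.map (cong suc) (cong suc) (∣m-n∣≡1 m k e)
    vertical-step : proj₁ p ≡ proj₁ q →
                    toℕ (proj₂ q) ≡ suc (toℕ (proj₂ p)) ⊎ toℕ (proj₂ p) ≡ suc (toℕ (proj₂ q)) →
                    Above p q ⊎ Above q p
    vertical-step p≡q = Sum.map (p≡q ,_) (sym p≡q ,_)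
  ... | inj₂ (d₁≡1 , d₂≡0) = inj₂ ((λ p≡q → 0≢1+n (trans (sym (m≡n⇒∣m-n∣≡0 (cong toℕ p≡q))) d₁≡1)) ,
                                   toℕ-injective (∣m-n∣≡0⇒m≡n d₂≡0))

  horizontal?≡not-vertical? : ∀ {n} (p q : Cell n) → Adjacent p q → horizontal? p q ≡ not (vertical? p q)
  horizontal?≡not-vertical? p q adj with adjacent-step p q adj
  ... | inj₁ (inj₁ (p≡q , q≡p+1)) rewrite dec-true (proj₁ p ≟ᶠ proj₁ q) p≡q =
    dec-false (proj₂ p ≟ᶠ proj₂ q) (λ e → 1+n≢n (trans (sym q≡p+1) (cong toℕ (sym e))))
  ... | inj₁ (inj₂ (q≡p , p≡q+1)) rewrite dec-true (proj₁ p ≟ᶠ proj₁ q) (sym q≡p) =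
    dec-false (proj₂ p ≟ᶠ proj₂ q) (λ e → 1+n≢n (trans (sym p≡q+1) (cong toℕ e)))
  ... | inj₂ (p≢q , p≡q) rewrite dec-false (proj₁ p ≟ᶠ proj₁ q) p≢q = dec-true (proj₂ p ≟ᶠ proj₂ q) p≡q

  turn≡vertical?-xor : ∀ {n} (p q r : Cell n) → Adjacent p q → Adjacent q r →
                       does (isTurn? p q r) ≡ vertical? q p xor vertical? q r
  turn≡vertical?-xor p q r pq qr
    rewrite horizontal?≡not-vertical? p q pq | horizontal?≡not-vertical? q r qr | vertical?-sym p q =
    xor-as-∨ (vertical? q p) (vertical? q r)
    where
    xor-as-∨ : ∀ a b → (not a ∧ b) ∨ (a ∧ not b) ≡ a xor b
    xor-as-∨ true  b = ∨-identityˡ (not b)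
    xor-as-∨ false b = ∨-identityʳ b

  vertical?≡isAbove∨isBelow : ∀ {n} (x y : Cell n) → Adjacent x y → vertical? x y ≡ isAbove x y ∨ isBelow x y
  vertical?≡isAbove∨isBelow x y adj with adjacent-step x y adj
  ... | inj₁ (inj₁ x↑y) rewrite dec-true (above? x y) x↑y = dec-true (proj₁ x ≟ᶠ proj₁ y) (proj₁ x↑y)
  ... | inj₁ (inj₂ y↑x) rewrite dec-true (above? y x) y↑x | ∨-zeroʳ (isAbove x y) =
    dec-true (proj₁ x ≟ᶠ proj₁ y) (sym (proj₁ y↑x))
  ... | inj₂ (x≢y , _) rewrite dec-false (above? x y) (x≢y ∘ proj₁) | dec-false (above? y x) (x≢y ∘ sym ∘ proj₁) =
    dec-false (proj₁ x ≟ᶠ proj₁ y) x≢y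

  turn≡isAbove-xor-isBelow : ∀ {n} (p x s : Cell n) → Adjacent p x → Adjacent x s → p ≢ s →
    does (isTurn? p x s) ≡ (isAbove x p ∨ isAbove x s) xor (isBelow x p ∨ isBelow x s)
  turn≡isAbove-xor-isBelow p x s px xs p≢s = begin
    does (isTurn? p x s)
      ≡⟨ turn≡vertical?-xor p x s px xs ⟩
    vertical? x p xor vertical? x s
      ≡⟨ cong₂ _xor_ (vertical?≡isAbove∨isBelow x p (adjacent-sym p x px)) (vertical?≡isAbove∨isBelow x s xs) ⟩
    (isAbove x p ∨ isBelow x p) xor (isAbove x s ∨ isBelow x s)
      ≡⟨ regroup (isAbove x p) (isBelow x p) (isAbove x s) (isBelow x s) (not-both p) (not-both s) two-above two-below ⟩
    (isAbove x p ∨ isAbove x s) xor (isBelow x p ∨ isBelow x s) ∎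
    where
    open ≡-Reasoning
    not-both : ∀ y → isAbove x y ∧ isBelow x y ≡ false
    not-both y = ∧-false λ x↑y y↑x → above-asym (witness (above? x y) x↑y) (witness (above? y x) y↑x)
    two-above : isAbove x p ∧ isAbove x s ≡ false
    two-above = ∧-false λ x↑p x↑s → p≢s (above-unique (witness (above? x p) x↑p) (witness (above? x s) x↑s))
    two-below : isBelow x p ∧ isBelow x s ≡ false
    two-below = ∧-false λ p↑x s↑x → p≢s (below-unique (witness (above? p x) p↑x) (witness (above? s x) s↑x))
    regroup : ∀ a b c d → a ∧ b ≡ false → c ∧ d ≡ false → a ∧ c ≡ false → b ∧ d ≡ false →
              (a ∨ b) xor (c ∨ d) ≡ (a ∨ c) xor (b ∨ d)
    regroup true  false false false _ _ _ _ = refl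
    regroup true  false false true  _ _ _ _ = refl
    regroup false true  false false _ _ _ _ = refl
    regroup false true  true  false _ _ _ _ = refl
    regroup false false true  false _ _ _ _ = refl
    regroup false false false true  _ _ _ _ = refl
    regroup false false false false _ _ _ _ = refl

module CycleStructure {n : ℕ} (H : HamiltonCycle n) (4≤n : 4 ≤ n) where

  open Counting
  open Parity
  open Grid

  N : ℕ
  N = n * n

  4<N : 4 < N
  4<N = <-≤-trans (s≤s (s≤s (s≤s (s≤s (s≤s z≤n))))) (*-mono-≤ 4≤n 4≤n)

  instance
    N-nonZero : NonZero N
    N-nonZero = >-nonZero (<-trans z<s 4<N)

  c : ℕ → Cell n
  c = cell H

  cell-mod : ∀ i → c i ≡ c (i % N)
  cell-mod i = trans (cong c (m≡m%n+[m/n]*n i N)) (periodic* (i % N) (i / N))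
    where
    periodic* : ∀ j q → c (j + q * N) ≡ c j
    periodic* j zero    = cong c (+-identityʳ j)
    periodic* j (suc q) = trans (cong c (+-assoc-comm j q)) (trans (periodic H (j + q * N)) (periodic* j q))
      where
      +-assoc-comm : ∀ j q → j + (N + q * N) ≡ j + q * N + N
      +-assoc-comm j q = trans (cong (j +_) (+-comm N (q * N))) (sym (+-assoc j (q * N) N))

  cell≡⇒%≡ : ∀ {i j} → c i ≡ c j → i % N ≡ j % N
  cell≡⇒%≡ {i} {j} e = injective H _ _ (m%n<n i N) (m%n<n j N) (trans (sym (cell-mod i)) (trans e (cell-mod j)))

  cell-shift : ∀ k {i j} → c i ≡ c j → c (k + i) ≡ c (k + j)
  cell-shift k {i} {j} e = begin
    c (k + i)                    ≡⟨ cell-mod (k + i) ⟩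
    c ((k + i) % N)              ≡⟨ cong c (%-distribˡ-+ k i N) ⟩
    c ((k % N + i % N) % N)      ≡⟨ cong (λ r → c ((k % N + r) % N)) (cell≡⇒%≡ e) ⟩
    c ((k % N + j % N) % N)      ≡⟨ cong c (%-distribˡ-+ k j N) ⟨
    c ((k + j) % N)              ≡⟨ cell-mod (k + j) ⟨
    c (k + j)                    ∎
    where open ≡-Reasoning

  suc-+pred-N : ∀ i → suc (i + pred N) ≡ i + N
  suc-+pred-N i = trans (sym (+-suc i (pred N))) (cong (i +_) (suc-pred N))

  pred-N+suc : ∀ i → pred N + suc i ≡ i + N
  pred-N+suc i = trans (+-comm (pred N) (suc i)) (suc-+pred-N i)

  cell-unshift : ∀ {i j} → c (suc i) ≡ c (suc j) → c i ≡ c j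
  cell-unshift {i} {j} e = begin
    c i                   ≡⟨ periodic H i ⟨
    c (i + N)             ≡⟨ cong c (pred-N+suc i) ⟨
    c (pred N + suc i)    ≡⟨ cell-shift (pred N) e ⟩
    c (pred N + suc j)    ≡⟨ cong c (pred-N+suc j) ⟩
    c (j + N)             ≡⟨ periodic H j ⟩
    c j                   ∎
    where open ≡-Reasoning

  -- Shifting by N ∸ (i % N) moves a coincidence c i ≡ c (d + i) to c 0 ≡ c d.
  cell-gap : ∀ i {d} → 0 < d → d < N → c i ≢ c (d + i)
  cell-gap i {d} 0<d d<N e = <⇒≢ 0<d (injective H 0 d (<-trans 0<d d<N) d<N c0≡cd)
    where
    open ≡-Reasoning
    r : ℕ
    r = i % N
    r≤N : r ≤ N
    r≤N = <⇒≤ (m%n<n i N)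
    cr≡cd+r : c r ≡ c (d + r)
    cr≡cd+r = trans (sym (cell-mod i)) (trans e (cell-shift d (cell-mod i)))
    c0≡cd : c 0 ≡ c d
    c0≡cd = begin
      c 0                   ≡⟨ periodic H 0 ⟨
      c N                   ≡⟨ cong c (m∸n+n≡m r≤N) ⟨
      c (N ∸ r + r)         ≡⟨ cell-shift (N ∸ r) cr≡cd+r ⟩
      c (N ∸ r + (d + r))   ≡⟨ cong (λ k → c (N ∸ r + k)) (+-comm d r) ⟩
      c (N ∸ r + (r + d))   ≡⟨ cong c (+-assoc (N ∸ r) r d) ⟨
      c (N ∸ r + r + d)     ≡⟨ cong (λ k → c (k + d)) (m∸n+n≡m r≤N) ⟩
      c (N + d)             ≡⟨ cong c (+-comm N d) ⟩
      c (d + N)             ≡⟨ periodic H d ⟩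
      c d                   ∎

  idx : Cell n → ℕ
  idx x = proj₁ (surjective H x)

  c-idx : ∀ x → c (idx x) ≡ x
  c-idx x = proj₂ (proj₂ (surjective H x))

  next prev : Cell n → Cell n
  next x = c (suc (idx x))
  prev x = c (idx x + pred N)

  c-suc-prev-idx : ∀ x → c (suc (idx x + pred N)) ≡ x
  c-suc-prev-idx x = trans (cong c (suc-+pred-N (idx x))) (trans (periodic H (idx x)) (c-idx x))

  next-of : ∀ {i x} → c i ≡ x → next x ≡ c (suc i)
  next-of {i} {x} ci≡x = cell-shift 1 (trans (c-idx x) (sym ci≡x))

  prev-of : ∀ {i x} → c (suc i) ≡ x → prev x ≡ c i
  prev-of {i} {x} ci+1≡x = cell-unshift (trans (c-suc-prev-idx x) (sym ci+1≡x))

  adjacent-prev : ∀ x → Adjacent (prev x) x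
  adjacent-prev x = subst (Adjacent (prev x)) (c-suc-prev-idx x) (adjacent H (idx x + pred N))

  adjacent-next : ∀ x → Adjacent x (next x)
  adjacent-next x = subst (λ y → Adjacent y (next x)) (c-idx x) (adjacent H (idx x))

  prev≢next : ∀ x → prev x ≢ next x
  prev≢next x e = cell-gap (idx x + pred N) {2} (s≤s z≤n) (<-trans (s≤s (s≤s (s≤s z≤n))) 4<N)
    (trans e (trans (sym (periodic H (suc (idx x)))) (cong (c ∘ suc) (sym (suc-+pred-N (idx x))))))

  Edge : Cell n → Cell n → Set
  Edge x y = prev x ≡ y ⊎ next x ≡ y

  Edge-sym : ∀ {x y} → Edge x y → Edge y x
  Edge-sym {x} (inj₁ prev≡y) = inj₂ (trans (next-of prev≡y) (c-suc-prev-idx x))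
  Edge-sym {x} (inj₂ next≡y) = inj₁ (trans (prev-of next≡y) (c-idx x))

  walk : ∀ {t x y} → c (suc t) ≡ x → Edge x y → c t ≢ y → c (suc (suc t)) ≡ y
  walk ct+1≡x (inj₁ prev≡y) ct≢y = contradiction (trans (sym (prev-of ct+1≡x)) prev≡y) ct≢y
  walk ct+1≡x (inj₂ next≡y) _    = trans (sym (next-of ct+1≡x)) next≡y

  no-4-cycle : ∀ {w x y z} → Edge w x → Edge w y → Edge x z → Edge y z → w ≢ z → x ≢ y → ⊥
  no-4-cycle (inj₁ prev≡x) (inj₁ prev≡y) _  _  _   x≢y = x≢y (trans (sym prev≡x) prev≡y)
  no-4-cycle (inj₂ next≡x) wy           xz yz w≢z x≢y = square next≡x xz (Edge-sym yz) (Edge-sym wy) w≢z x≢y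
    where
    square : ∀ {w x y z} → next w ≡ x → Edge x z → Edge z y → Edge y w → w ≢ z → x ≢ y → ⊥
    square {w} {x} {y} {z} next≡x xz zy yw w≢z x≢y =
      cell-gap t (s≤s z≤n) 4<N (trans (c-idx w) (sym (walk c₃ yw (λ e → w≢z (sym (trans (sym c₂) e))))))
      where
      t : ℕ
      t = idx w
      c₁ : c (suc t) ≡ x
      c₁ = next≡x
      c₂ : c (suc (suc t)) ≡ z
      c₂ = walk c₁ xz (λ e → w≢z (trans (sym (c-idx w)) e))
      c₃ : c (suc (suc (suc t))) ≡ y
      c₃ = walk c₂ zy (λ e → x≢y (trans (sym c₁) e))
  no-4-cycle (inj₁ prev≡x) (inj₂ next≡y) xz yz w≢z x≢y =
    no-4-cycle (inj₂ next≡y) (inj₁ prev≡x) yz xz w≢z (x≢y ∘ sym)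

  turnAt : ℕ → Bool
  turnAt t = does (isTurn? (c t) (c (suc t)) (c (suc (suc t))))

  turns≡count-turnAt : turns H ≡ count turnAt N
  turns≡count-turnAt = length-filter-upTo (λ t → isTurn? (c t) (c (suc t)) (c (suc (suc t)))) N

  isTurnCell : Cell n → Bool
  isTurnCell x = does (isTurn? (prev x) x (next x))

  turnAt≡isTurnCell : ∀ {t x} → c (suc t) ≡ x → turnAt t ≡ isTurnCell x
  turnAt≡isTurnCell {t} refl =
    cong₂ (λ p s → does (isTurn? p (c (suc t)) s)) (sym (prev-of refl)) (sym (next-of refl))

  predIdx : Cell n → ℕ
  predIdx x = (idx x + pred N) % N

  predIdx<N : ∀ x → predIdx x < N
  predIdx<N x = m%n<n (idx x + pred N) N

  c-suc-predIdx : ∀ x → c (suc (predIdx x)) ≡ x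
  c-suc-predIdx x = trans (cell-shift 1 (sym (cell-mod (idx x + pred N)))) (c-suc-prev-idx x)

  module Neighbour {R : Cell n → Cell n → Set} (R? : ∀ x y → Dec (R x y)) where

    has : Cell n → Bool
    has x = does (R? x (prev x)) ∨ does (R? x (next x))

    Edge⇒has : ∀ {x y} → R x y → Edge x y → has x ≡ true
    Edge⇒has {x} {y} xRy (inj₁ prev≡y) =
      cong (_∨ does (R? x (next x))) (trans (cong (does ∘ R? x) prev≡y) (dec-true (R? x y) xRy))
    Edge⇒has {x} {y} xRy (inj₂ next≡y) =
      trans (cong (does (R? x (prev x)) ∨_) (trans (cong (does ∘ R? x) next≡y) (dec-true (R? x y) xRy))) (∨-zeroʳ _)

    has⇒Edge : ∀ {x y} → (∀ {p s} → R x p → R x s → p ≡ s) → R x y → has x ≡ true → Edge x y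
    has⇒Edge {x} unique xRy h with does (R? x (prev x)) in e
    ... | true  = inj₁ (unique (witness (R? x (prev x)) e) xRy)
    ... | false = inj₂ (unique (witness (R? x (next x)) h) xRy)

  open Neighbour above?
    using () renaming (has to hasAbove; Edge⇒has to Edge⇒hasAbove; has⇒Edge to hasAbove⇒Edge)
  open Neighbour (λ x y → above? y x)
    using () renaming (has to hasBelow; Edge⇒has to Edge⇒hasBelow; has⇒Edge to hasBelow⇒Edge)

  isTurnCell≡hasAbove-xor-hasBelow : ∀ x → isTurnCell x ≡ hasAbove x xor hasBelow x
  isTurnCell≡hasAbove-xor-hasBelow x =
    turn≡isAbove-xor-isBelow (prev x) x (next x) (adjacent-prev x) (adjacent-next x) (prev≢next x)

  hasAbove≡hasBelow : ∀ {x y} → Above x y → hasAbove x ≡ hasBelow y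
  hasAbove≡hasBelow x↑y = bool-ext
    (Edge⇒hasBelow x↑y ∘ Edge-sym ∘ hasAbove⇒Edge above-unique x↑y)
    (Edge⇒hasAbove x↑y ∘ Edge-sym ∘ hasBelow⇒Edge below-unique x↑y)

  instance
    n-nonZero : NonZero n
    n-nonZero = >-nonZero (<-≤-trans z<s 4≤n)

  cellAt : Fin n → ℕ → Cell n
  cellAt a b = a , fromℕ-mod b

  -- edgeBelow a b: the cycle uses the edge from (a , b ∸ 1) to (a , b); false outside 0 < b < n.
  edgeBelow : Fin n → ℕ → Bool
  edgeBelow a b = if does (b <? n) then hasBelow (cellAt a b) else false

  edgeBelow-inside : ∀ a {b} → b < n → edgeBelow a b ≡ hasBelow (cellAt a b)
  edgeBelow-inside a {b} b<n rewrite dec-true (b <? n) b<n = refl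

  edgeBelow-outside : ∀ a {b} → ¬ b < n → edgeBelow a b ≡ false
  edgeBelow-outside a {b} b≮n rewrite dec-false (b <? n) b≮n = refl

  edgeBelow-0 : ∀ a → edgeBelow a 0 ≡ false
  edgeBelow-0 a = trans (edgeBelow-inside a 0<n) (cong₂ _∨_ (bottom (prev x)) (bottom (next x)))
    where
    0<n : 0 < n
    0<n = <-≤-trans z<s 4≤n
    x : Cell n
    x = cellAt a 0
    bottom : ∀ y → isBelow x y ≡ false
    bottom y = dec-false (above? y x) λ (_ , x≡y+1) → 0≢1+n (trans (sym (toℕ-fromℕ-mod 0<n)) x≡y+1)

  hasAbove-cellAt : ∀ a {b} → b < n → hasAbove (cellAt a b) ≡ edgeBelow a (suc b)
  hasAbove-cellAt a {b} b<n with suc b <? n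
  ... | yes b+1<n =
    trans (hasAbove≡hasBelow (refl , trans (toℕ-fromℕ-mod b+1<n) (cong suc (sym (toℕ-fromℕ-mod b<n)))))
          (sym (edgeBelow-inside a b+1<n))
  ... | no  b+1≮n = trans (cong₂ _∨_ (top (prev x)) (top (next x))) (sym (edgeBelow-outside a b+1≮n))
    where
    x : Cell n
    x = cellAt a b
    top : ∀ y → isAbove x y ≡ false
    top y = dec-false (above? x y) λ (_ , y≡x+1) →
      b+1≮n (subst (_< n) (trans y≡x+1 (cong suc (toℕ-fromℕ-mod b<n))) (toℕ<n (proj₂ y)))

  isTurnCell-cellAt : ∀ a {b} → b < n → isTurnCell (cellAt a b) ≡ toggles (edgeBelow a) b
  isTurnCell-cellAt a {b} b<n = begin
    isTurnCell (cellAt a b)                                ≡⟨ isTurnCell≡hasAbove-xor-hasBelow (cellAt a b) ⟩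
    hasAbove (cellAt a b) xor hasBelow (cellAt a b)        ≡⟨ cong₂ _xor_ (hasAbove-cellAt a b<n) (sym (edgeBelow-inside a b<n)) ⟩
    edgeBelow a (suc b) xor edgeBelow a b                  ≡⟨ xor-comm (edgeBelow a (suc b)) (edgeBelow a b) ⟩
    toggles (edgeBelow a) b                                ∎
    where open ≡-Reasoning

  another-straight-in-column : isOdd n ≡ false → ∀ a {b₀} → b₀ < n → isTurnCell (cellAt a b₀) ≡ false →
                               ∃[ b₁ ] b₁ < n × b₁ ≢ b₀ × isTurnCell (cellAt a b₁) ≡ false
  another-straight-in-column n-even a {b₀} b₀<n straight = from-steady
    (another-steady-step (edgeBelow a) n n-even (trans (edgeBelow-0 a) (sym (edgeBelow-outside a (<-irrefl refl))))
                         b₀ b₀<n (trans (sym (isTurnCell-cellAt a b₀<n)) straight))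
    where
    from-steady : ∃[ b₁ ] b₁ < n × b₁ ≢ b₀ × toggles (edgeBelow a) b₁ ≡ false →
                  ∃[ b₁ ] b₁ < n × b₁ ≢ b₀ × isTurnCell (cellAt a b₁) ≡ false
    from-steady (b₁ , b₁<n , b₁≢b₀ , steady) = b₁ , b₁<n , b₁≢b₀ , trans (isTurnCell-cellAt a b₁<n) steady

  turning-column-edge : ∀ a → (∀ b → b < n → isTurnCell (cellAt a b) ≡ true) →
                        ∀ l → suc (l * 2) < n → Edge (cellAt a (l * 2)) (cellAt a (suc (l * 2)))
  turning-column-edge a all-turns l 2l+1<n = hasAbove⇒Edge above-unique
    (refl , trans (toℕ-fromℕ-mod 2l+1<n) (cong suc (sym (toℕ-fromℕ-mod (<-trans (n<1+n _) 2l+1<n)))))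
    (begin
      hasAbove (cellAt a (l * 2))    ≡⟨ hasAbove-cellAt a (<-trans (n<1+n _) 2l+1<n) ⟩
      edgeBelow a (suc (l * 2))      ≡⟨ alternating (edgeBelow a) n (edgeBelow-0 a) toggling (suc (l * 2)) (<⇒≤ 2l+1<n) ⟩
      not (isOdd (l * 2))            ≡⟨ cong not (isOdd-*2 l) ⟩
      true                           ∎)
    where
    open ≡-Reasoning
    toggling : ∀ b → b < n → toggles (edgeBelow a) b ≡ true
    toggling b b<n = trans (sym (isTurnCell-cellAt a b<n)) (all-turns b b<n)

module Transpose where

  adjacent-swap : ∀ {n} {p q : Cell n} → Adjacent p q → Adjacent (swap p) (swap q)
  adjacent-swap {p = p} {q} = trans (+-comm ∣ toℕ (proj₂ p) - toℕ (proj₂ q) ∣ ∣ toℕ (proj₁ p) - toℕ (proj₁ q) ∣)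

  transpose : ∀ {n} → HamiltonCycle n → HamiltonCycle n
  transpose H = record
    { cell       = swap ∘ cell H
    ; periodic   = cong swap ∘ periodic H
    ; adjacent   = λ i → adjacent-swap {p = cell H i} {cell H (suc i)} (adjacent H i)
    ; injective  = λ i j i<N j<N ci≡cj → injective H i j i<N j<N (cong swap ci≡cj)
    ; surjective = λ x → proj₁ (surjective H (swap x)) , proj₁ (proj₂ (surjective H (swap x))) ,
                         cong swap (proj₂ (proj₂ (surjective H (swap x))))
    }

  turns-transpose : ∀ {n} (H : HamiltonCycle n) → turns (transpose H) ≡ turns H
  turns-transpose {n} H = begin
    turns (transpose H)
      ≡⟨ length-filter-upTo (λ t → isTurn? (swap (c t)) (swap (c (suc t))) (swap (c (suc (suc t))))) (n * n) ⟩
    count (λ t → does (isTurn? (swap (c t)) (swap (c (suc t))) (swap (c (suc (suc t)))))) (n * n)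
      ≡⟨ count-cong (n * n) (λ t _ → turn-swap (c t) (c (suc t)) (c (suc (suc t)))) ⟩
    count (λ t → does (isTurn? (c t) (c (suc t)) (c (suc (suc t))))) (n * n)
      ≡⟨ length-filter-upTo (λ t → isTurn? (c t) (c (suc t)) (c (suc (suc t)))) (n * n) ⟨
    turns H ∎
    where
    open ≡-Reasoning
    open Counting
    c : ℕ → Cell n
    c = cell H
    turn-swap : ∀ (p q r : Cell n) → does (isTurn? (swap p) (swap q) (swap r)) ≡ does (isTurn? p q r)
    turn-swap p q r = ∨-comm (does (proj₁ p ≟ᶠ proj₁ q) ∧ does (proj₂ q ≟ᶠ proj₂ r)) _

module UpperBound {n : ℕ} (4≤n : 4 ≤ n) (K : ℕ) (n≡K*2 : n ≡ K * 2) where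

  open Counting
  open Parity
  open Grid
  open Transpose

  instance
    n-nonZero : NonZero n
    n-nonZero = >-nonZero (<-≤-trans z<s 4≤n)

  column : ℕ → Fin n
  column = fromℕ-mod

  n-even : isOdd n ≡ false
  n-even = trans (cong isOdd n≡K*2) (isOdd-*2 K)

  pair-columns<n : ∀ {k} → k < K → suc (k * 2) < n
  pair-columns<n {k} k<K = subst (suc (suc (k * 2)) ≤_) (sym n≡K*2) (*-monoˡ-≤ 2 k<K)

  ⌊k*2/2⌋≡k : ∀ k → ⌊ k * 2 /2⌋ ≡ k
  ⌊k*2/2⌋≡k zero    = refl
  ⌊k*2/2⌋≡k (suc k) = cong suc (⌊k*2/2⌋≡k k)

  ⌊1+k*2/2⌋≡k : ∀ k → ⌊ suc (k * 2) /2⌋ ≡ k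
  ⌊1+k*2/2⌋≡k zero    = refl
  ⌊1+k*2/2⌋≡k (suc k) = cong suc (⌊1+k*2/2⌋≡k k)

  module Columns (H : HamiltonCycle n) where

    open CycleStructure H 4≤n public

    StraightIn : ℕ → Set
    StraightIn j = ∃[ b ] b < n × isTurnCell (cellAt (column j) b) ≡ false

    PairStraight : ℕ → Set
    PairStraight k = StraightIn (k * 2) ⊎ StraightIn (suc (k * 2))

    pairStraight? : ∀ k → Dec (PairStraight k)
    pairStraight? k = straightIn? (k * 2) ⊎-dec straightIn? (suc (k * 2))
      where
      straightIn? : ∀ j → Dec (StraightIn j)
      straightIn? j = anyUpTo? (λ b → isTurnCell (cellAt (column j) b) Bool.≟ false) n

    label : ℕ → ℕ
    label t = ⌊ toℕ (proj₁ (c (suc t))) /2⌋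

    straight-pair : ∀ {j k} → j < n → ⌊ j /2⌋ ≡ k → StraightIn j → LabelledPair (not ∘ turnAt) N label k
    straight-pair {j} {k} j<n j/2≡k (b₀ , b₀<n , straight₀) =
      from-second (another-straight-in-column n-even (column j) b₀<n straight₀)
      where
      from-second : ∃[ b₁ ] b₁ < n × b₁ ≢ b₀ × isTurnCell (cellAt (column j) b₁) ≡ false →
                    LabelledPair (not ∘ turnAt) N label k
      from-second (b₁ , b₁<n , b₁≢b₀ , straight₁) =
        predIdx x₀ , predIdx x₁ , predIdx<N x₀ , predIdx<N x₁ , distinct ,
        non-turn x₀ straight₀ , non-turn x₁ straight₁ , labelled , labelled
        where
        x₀ x₁ : Cell n
        x₀ = cellAt (column j) b₀
        x₁ = cellAt (column j) b₁
        distinct : predIdx x₀ ≢ predIdx x₁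
        t₀ t₁ : ℕ
        t₀ = predIdx x₀
        t₁ = predIdx x₁
        distinct t₀≡t₁ = b₁≢b₀ (begin
          b₁                       ≡⟨ toℕ-fromℕ-mod b₁<n ⟨
          toℕ (proj₂ x₁)           ≡⟨ cong (toℕ ∘ proj₂) (c-suc-predIdx x₁) ⟨
          toℕ (proj₂ (c (suc t₁))) ≡⟨ cong (toℕ ∘ proj₂ ∘ c ∘ suc) t₀≡t₁ ⟨
          toℕ (proj₂ (c (suc t₀))) ≡⟨ cong (toℕ ∘ proj₂) (c-suc-predIdx x₀) ⟩
          toℕ (proj₂ x₀)           ≡⟨ toℕ-fromℕ-mod b₀<n ⟩
          b₀                       ∎)
          where open ≡-Reasoning
        non-turn : ∀ x → isTurnCell x ≡ false → not (turnAt (predIdx x)) ≡ true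
        non-turn x straight = cong not (trans (turnAt≡isTurnCell (c-suc-predIdx x)) straight)
        labelled : ∀ {b} → label (predIdx (cellAt (column j) b)) ≡ k
        labelled {b} = trans (cong (⌊_/2⌋ ∘ toℕ ∘ proj₁) (c-suc-predIdx (cellAt (column j) b)))
                             (trans (cong ⌊_/2⌋ (toℕ-fromℕ-mod j<n)) j/2≡k)

    turns≤-if-pairs-straight : (∀ k → k < K → PairStraight k) → turns H ≤ N ∸ n
    turns≤-if-pairs-straight straight = begin
      turns H                                     ≡⟨ turns≡count-turnAt ⟩
      count turnAt N                              ≡⟨ m+n∸n≡m (count turnAt N) (count (not ∘ turnAt) N) ⟨
      count turnAt N + count (not ∘ turnAt) N ∸ count (not ∘ turnAt) N
                                                  ≡⟨ cong (_∸ count (not ∘ turnAt) N) (count-complement turnAt N) ⟩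
      N ∸ count (not ∘ turnAt) N                  ≤⟨ ∸-monoʳ-≤ N pairs ⟩
      N ∸ n                                       ∎
      where
      open ≤-Reasoning
      pairs : n ≤ count (not ∘ turnAt) N
      pairs = subst (_≤ count (not ∘ turnAt) N) (trans (*-comm 2 K) (sym n≡K*2))
                    (2*≤count-by-pairs N label K λ k k<K → pair k k<K (straight k k<K))
        where
        pair : ∀ k → k < K → PairStraight k → LabelledPair (not ∘ turnAt) N label k
        pair k k<K (inj₁ s) = straight-pair (<-trans (n<1+n _) (pair-columns<n k<K)) (⌊k*2/2⌋≡k k) s
        pair k k<K (inj₂ s) = straight-pair (pair-columns<n k<K) (⌊1+k*2/2⌋≡k k) s

    AllTurns : ℕ → Set
    AllTurns j = ∀ b → b < n → isTurnCell (cellAt (column j) b) ≡ true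

    ¬StraightIn⇒AllTurns : ∀ {j} → ¬ StraightIn j → AllTurns j
    ¬StraightIn⇒AllTurns ¬straight b b<n = ¬-not λ straight → ¬straight (b , b<n , straight)

  -- Turning columns 2k, 2k + 1 of H and 2l, 2l + 1 of its transpose contain a 4-cycle of H.
  no-turning-square : ∀ (H : HamiltonCycle n) {k l} → k < K → l < K →
                      ¬ Columns.PairStraight H k → ¬ Columns.PairStraight (transpose H) l → ⊥
  no-turning-square H {k} {l} k<K l<K ¬straight ¬straightᵀ = no-4-cycle w─x w─y x─z y─z a₀≢a₁ a₀≢a₁
    where
    open Columns H
    module ᵀ = Columns (transpose H)
    from-transpose : ∀ {u v} → ᵀ.Edge u v → Edge (swap u) (swap v)
    from-transpose = Sum.map (cong swap) (cong swap)
    a₀ a₁ : Fin n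
    a₀ = column (k * 2)
    a₁ = column (suc (k * 2))
    w─x : Edge (cellAt a₀ (l * 2)) (cellAt a₀ (suc (l * 2)))
    w─x = turning-column-edge a₀ (¬StraightIn⇒AllTurns (¬straight ∘ inj₁)) l (pair-columns<n l<K)
    y─z : Edge (cellAt a₁ (l * 2)) (cellAt a₁ (suc (l * 2)))
    y─z = turning-column-edge a₁ (¬StraightIn⇒AllTurns (¬straight ∘ inj₂)) l (pair-columns<n l<K)
    w─y : Edge (cellAt a₀ (l * 2)) (cellAt a₁ (l * 2))
    w─y = from-transpose (ᵀ.turning-column-edge (column (l * 2))
            (ᵀ.¬StraightIn⇒AllTurns (¬straightᵀ ∘ inj₁)) k (pair-columns<n k<K))
    x─z : Edge (cellAt a₀ (suc (l * 2))) (cellAt a₁ (suc (l * 2)))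
    x─z = from-transpose (ᵀ.turning-column-edge (column (suc (l * 2)))
            (ᵀ.¬StraightIn⇒AllTurns (¬straightᵀ ∘ inj₂)) k (pair-columns<n k<K))
    a₀≢a₁ : ∀ {b b′} → cellAt a₀ b ≢ cellAt a₁ b′
    a₀≢a₁ e = 1+n≢n (sym (begin
      k * 2              ≡⟨ toℕ-fromℕ-mod (<-trans (n<1+n _) (pair-columns<n k<K)) ⟨
      toℕ a₀             ≡⟨ cong (toℕ ∘ proj₁) e ⟩
      toℕ a₁             ≡⟨ toℕ-fromℕ-mod (pair-columns<n k<K) ⟩
      suc (k * 2)        ∎))
      where open ≡-Reasoning

  every-pair-straight : ∀ H → ¬ (∃[ k ] k < K × ¬ Columns.PairStraight H k) →
                        ∀ k → k < K → Columns.PairStraight H k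
  every-pair-straight H none k k<K =
    decidable-stable (Columns.pairStraight? H k) λ ¬straight → none (k , k<K , ¬straight)

  turns≤ : (H : HamiltonCycle n) → turns H ≤ n * n ∸ n
  turns≤ H with anyUpTo? (¬? ∘ Columns.pairStraight? H) K
  ... | no none = Columns.turns≤-if-pairs-straight H (every-pair-straight H none)
  ... | yes (k , k<K , ¬straight) with anyUpTo? (¬? ∘ Columns.pairStraight? (transpose H)) K
  ...   | no none = subst (_≤ n * n ∸ n) (turns-transpose H)
                      (Columns.turns≤-if-pairs-straight (transpose H) (every-pair-straight (transpose H) none))
  ...   | yes (l , l<K , ¬straightᵀ) = ⊥-elim (no-turning-square H k<K l<K ¬straight ¬straightᵀ)

<ᵇ-true : ∀ {a b} → (a <ᵇ b) ≡ true → a < b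
<ᵇ-true {a} {b} a<ᵇb = <ᵇ⇒< a b (subst T (sym a<ᵇb) tt)

<ᵇ-false : ∀ {a b} → (a <ᵇ b) ≡ false → b ≤ a
<ᵇ-false a≮ᵇb = ≮⇒≥ λ a<b → subst T a≮ᵇb (<⇒<ᵇ a<b)

≮⇒<ᵇ≡false : ∀ {a b} → ¬ a < b → (a <ᵇ b) ≡ false
≮⇒<ᵇ≡false {a} {b} a≮b with a <ᵇ b in a<ᵇb
... | false = refl
... | true  = contradiction (<ᵇ-true a<ᵇb) a≮b

<⇒<ᵇ≡true : ∀ {a b} → a < b → (a <ᵇ b) ≡ true
<⇒<ᵇ≡true a<b = Equivalence.to T-≡ (<⇒<ᵇ a<b)

∣n-1+n∣≡1 : ∀ a → ∣ a - suc a ∣ ≡ 1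
∣n-1+n∣≡1 zero    = refl
∣n-1+n∣≡1 (suc a) = ∣n-1+n∣≡1 a

%-+* : ∀ d .{{_ : NonZero d}} {k} j → k < d → (k + j * d) % d ≡ k
%-+* d {k} j k<d = trans ([m+kn]%n≡m%n k j d) (m<n⇒m%n≡m k<d)

/-+* : ∀ d .{{_ : NonZero d}} {k} j → k < d → (k + j * d) / d ≡ j
/-+* d {k} j k<d = trans (+-distrib-/-∣ʳ k (divides-refl j)) (cong₂ _+_ (m<n⇒m/n≡0 k<d) (m*n/n≡m j d))

+-*-injective : ∀ d .{{_ : NonZero d}} {k k′} j j′ → k < d → k′ < d → k + j * d ≡ k′ + j′ * d → k ≡ k′ × j ≡ j′
+-*-injective d j j′ k<d k′<d e =
  trans (sym (%-+* d j k<d)) (trans (cong (_% d) e) (%-+* d j′ k′<d)) ,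
  trans (sym (/-+* d j k<d)) (trans (cong (_/ d) e) (/-+* d j′ k′<d))

injective⇒surjective : ∀ {N} (f : Fin N → Fin N) → (∀ {i j} → f i ≡ f j → i ≡ j) → ∀ y → ∃[ i ] f i ≡ y
injective⇒surjective {suc N} f injective y with any? (λ i → f i ≟ᶠ y)
... | yes hit  = hit
... | no  miss = contradiction (injective⇒≤ punched-injective) (<-irrefl refl)
  where
  avoid : ∀ i → y ≢ f i
  avoid i y≡fi = miss (i , sym y≡fi)
  punched-injective : ∀ {i j} → punchOut (avoid i) ≡ punchOut (avoid j) → i ≡ j
  punched-injective = injective ∘ punchOut-injective (avoid _) (avoid _)

injective⇒covering : ∀ {n} (c : ℕ → Cell n) → (∀ i j → i < n * n → j < n * n → c i ≡ c j → i ≡ j) →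
                     ∀ x → ∃[ i ] i < n * n × c i ≡ x
injective⇒covering {n} c injective x with injective⇒surjective f f-injective (combine (proj₁ x) (proj₂ x))
  where
  f : Fin (n * n) → Fin (n * n)
  f i = combine (proj₁ (c (toℕ i))) (proj₂ (c (toℕ i)))
  f-injective : ∀ {i j} → f i ≡ f j → i ≡ j
  f-injective {i} {j} fi≡fj with combine-injective _ _ _ _ fi≡fj
  ... | e₁ , e₂ = toℕ-injective (injective (toℕ i) (toℕ j) (toℕ<n i) (toℕ<n j) (×-≡,≡→≡ (e₁ , e₂)))
... | i , fi≡x with combine-injective _ _ _ _ fi≡x
...   | e₁ , e₂ = toℕ i , toℕ<n i , ×-≡,≡→≡ (e₁ , e₂)

-- In `down j r s` and `up j r s`, r is the number of columns the zigzag has passed and s selects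
-- the first or the second of its two cells in the current column.
data Pos : Set where
  enter  : ℕ → Pos
  down   : ℕ → ℕ → Bool → Pos
  bottom : ℕ → Fin 8 → Pos
  up     : ℕ → ℕ → Bool → Pos
  leave  : ℕ → Pos
  back   : ℕ → Fin 6 → Pos

module Tour (m′ : ℕ) where

  open Counting using (bit; count; count≤-by-code; count-complement)
  open Parity using (isOdd; isOdd-*2)
  open Grid using (vertical?)

  m n L : ℕ
  m = suc m′
  n = m * 4
  L = m′ * 4

  L-even : isOdd L ≡ false
  L-even = trans (cong isOdd (sym (*-assoc m′ 2 2))) (isOdd-*2 (m′ * 2))

  next : Pos → Pos
  next (enter j)        = if 0 <ᵇ L then down j 0 false else bottom j 0F
  next (down j r false) = down j r true
  next (down j r true)  = if suc r <ᵇ L then down j (suc r) false else bottom j 0F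
  next (bottom j 0F)    = bottom j 1F
  next (bottom j 1F)    = bottom j 2F
  next (bottom j 2F)    = bottom j 3F
  next (bottom j 3F)    = bottom j 4F
  next (bottom j 4F)    = bottom j 5F
  next (bottom j 5F)    = bottom j 6F
  next (bottom j 6F)    = bottom j 7F
  next (bottom j 7F)    = if 0 <ᵇ L then up j 0 false else leave j
  next (up j r false)   = up j r true
  next (up j r true)    = if suc r <ᵇ L then up j (suc r) false else leave j
  next (leave j)        = if suc j <ᵇ m then enter (suc j) else back j 0F
  next (back j 0F)      = back j 1F
  next (back j 1F)      = back j 2F
  next (back j 2F)      = back j 3F
  next (back j 3F)      = back j 4F
  next (back j 4F)      = back j 5F
  next (back zero 5F)   = enter 0
  next (back (suc j) 5F) = back j 0F

  Valid : Pos → Set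
  Valid (enter j)    = j < m
  Valid (down j r _) = j < m × r < L
  Valid (bottom j _) = j < m
  Valid (up j r _)   = j < m × r < L
  Valid (leave j)    = j < m
  Valid (back j _)   = j < m

  bottomDepth : Fin 8 → ℕ
  bottomDepth 1F = 1
  bottomDepth 2F = 1
  bottomDepth 5F = 1
  bottomDepth 6F = 1
  bottomDepth _  = 0

  backX backY : Fin 6 → ℕ
  backX 2F = 1
  backX 3F = 1
  backX _  = 0
  backY 0F = 3
  backY 1F = 2
  backY 2F = 2
  backY 3F = 1
  backY 4F = 1
  backY 5F = 0

  block yOffset : Pos → ℕ
  block (enter j)      = j
  block (down j _ _)   = j
  block (bottom j _)   = j
  block (up j _ _)     = j
  block (leave j)      = j
  block (back j _)     = j
  yOffset (enter _)    = 0
  yOffset (down _ r s) = bit (isOdd r xor s)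
  yOffset (bottom _ e) = ⌊ toℕ e /2⌋
  yOffset (up _ r s)   = 2 + bit (not (isOdd r xor s))
  yOffset (leave _)    = 3
  yOffset (back _ e)   = backY e

  xOf yOf : Pos → ℕ
  xOf (enter _)    = 1
  xOf (down _ r _) = 2 + r
  xOf (bottom _ e) = 2 + (bottomDepth e + L)
  xOf (up _ r _)   = 2 + (L ∸ suc r)
  xOf (leave _)    = 1
  xOf (back _ e)   = backX e
  yOf p = yOffset p + block p * 4

  verticalStep : Pos → Bool
  verticalStep (enter _)      = false
  verticalStep (down _ _ s)   = not s
  verticalStep (bottom _ 1F)  = true
  verticalStep (bottom _ 3F)  = true
  verticalStep (bottom _ 5F)  = true
  verticalStep (bottom _ _)   = false
  verticalStep (up _ _ s)     = not s
  verticalStep (leave j)      = suc j <ᵇ m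
  verticalStep (back _ 0F)      = true
  verticalStep (back _ 1F)      = false
  verticalStep (back _ 2F)      = true
  verticalStep (back _ 3F)      = false
  verticalStep (back _ 4F)      = true
  verticalStep (back zero 5F)   = false
  verticalStep (back (suc _) 5F) = true

  Step : Bool → ℕ → ℕ → ℕ → ℕ → Set
  Step true  x y x′ y′ = x′ ≡ x × (y′ ≡ suc y ⊎ y ≡ suc y′)
  Step false x y x′ y′ = y′ ≡ y × (x′ ≡ suc x ⊎ x ≡ suc x′)

  bit<2 : ∀ b → bit b < 2
  bit<2 true  = ≤-refl
  bit<2 false = s≤s z≤n

  xor-not-false : ∀ b → not b xor false ≡ b xor true
  xor-not-false true  = refl
  xor-not-false false = refl

  L≡0 : (0 <ᵇ L) ≡ false → L ≡ 0
  L≡0 0≮ᵇL = n≤0⇒n≡0 (<ᵇ-false {0} {L} 0≮ᵇL)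

  last-row : ∀ {r} → r < L → (suc r <ᵇ L) ≡ false → suc r ≡ L
  last-row r<L r+1≮L = ≤-antisym r<L (<ᵇ-false r+1≮L)

  last-row-odd : ∀ {r} → suc r ≡ L → isOdd r ≡ true
  last-row-odd {r} r+1≡L = not≡false (trans (cong isOdd r+1≡L) L-even)
    where
    not≡false : ∀ {b} → not b ≡ false → b ≡ true
    not≡false {true} _ = refl

  step : ∀ p → Valid p → Step (verticalStep p) (xOf p) (yOf p) (xOf (next p)) (yOf (next p))
  step (enter j) _ with 0 <ᵇ L in 0<ᵇL
  ... | true  = refl , inj₁ refl
  ... | false = refl , inj₁ (cong (2 +_) (L≡0 0<ᵇL))
  step (down j r false) _ with isOdd r
  ... | true  = refl , inj₂ refl
  ... | false = refl , inj₁ refl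
  step (down j r true) (_ , r<L) with suc r <ᵇ L in r+1<ᵇL
  ... | true  = cong (λ b → bit b + j * 4) (xor-not-false (isOdd r)) , inj₁ refl
  ... | false rewrite last-row-odd (last-row r<L r+1<ᵇL) = refl , inj₁ (cong (2 +_) (sym (last-row r<L r+1<ᵇL)))
  step (bottom j 0F) _ = refl , inj₁ refl
  step (bottom j 1F) _ = refl , inj₁ refl
  step (bottom j 2F) _ = refl , inj₂ refl
  step (bottom j 3F) _ = refl , inj₁ refl
  step (bottom j 4F) _ = refl , inj₁ refl
  step (bottom j 5F) _ = refl , inj₁ refl
  step (bottom j 6F) _ = refl , inj₂ refl
  step (bottom j 7F) _ with 0 <ᵇ L in 0<ᵇL
  ... | true  = refl , inj₂ (cong (2 +_) (trans (sym (m∸n+n≡m (<ᵇ-true 0<ᵇL))) (+-comm (L ∸ 1) 1)))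
  ... | false = refl , inj₂ (cong (2 +_) (L≡0 0<ᵇL))
  step (up j r false) _ with isOdd r
  ... | true  = refl , inj₁ refl
  ... | false = refl , inj₂ refl
  step (up j r true) (_ , r<L) with suc r <ᵇ L in r+1<ᵇL
  ... | true  = cong (λ b → 2 + bit (not b) + j * 4) (xor-not-false (isOdd r)) ,
                inj₂ (cong (2 +_) (+-∸-assoc 1 {L} (<ᵇ-true r+1<ᵇL)))
  ... | false rewrite last-row-odd (last-row r<L r+1<ᵇL) =
                refl , inj₂ (cong (2 +_) (trans (cong (L ∸_) (last-row r<L r+1<ᵇL)) (n∸n≡0 L)))
  step (leave j) _ with suc j <ᵇ m
  ... | true  = refl , inj₁ refl
  ... | false = refl , inj₂ refl
  step (back j 0F)       _ = refl , inj₂ refl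
  step (back j 1F)       _ = refl , inj₁ refl
  step (back j 2F)       _ = refl , inj₂ refl
  step (back j 3F)       _ = refl , inj₂ refl
  step (back j 4F)       _ = refl , inj₂ refl
  step (back zero 5F)    _ = refl , inj₁ refl
  step (back (suc j) 5F) _ = refl , inj₂ refl

  next-valid : ∀ p → Valid p → Valid (next p)
  next-valid (enter j) j<m with 0 <ᵇ L in 0<ᵇL
  ... | true  = j<m , <ᵇ-true 0<ᵇL
  ... | false = j<m
  next-valid (down j r false) v = v
  next-valid (down j r true) (j<m , _) with suc r <ᵇ L in r+1<ᵇL
  ... | true  = j<m , <ᵇ-true r+1<ᵇL
  ... | false = j<m
  next-valid (bottom j 0F) j<m = j<m
  next-valid (bottom j 1F) j<m = j<m
  next-valid (bottom j 2F) j<m = j<m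
  next-valid (bottom j 3F) j<m = j<m
  next-valid (bottom j 4F) j<m = j<m
  next-valid (bottom j 5F) j<m = j<m
  next-valid (bottom j 6F) j<m = j<m
  next-valid (bottom j 7F) j<m with 0 <ᵇ L in 0<ᵇL
  ... | true  = j<m , <ᵇ-true 0<ᵇL
  ... | false = j<m
  next-valid (up j r false) v = v
  next-valid (up j r true) (j<m , _) with suc r <ᵇ L in r+1<ᵇL
  ... | true  = j<m , <ᵇ-true r+1<ᵇL
  ... | false = j<m
  next-valid (leave j) j<m with suc j <ᵇ m in j+1<ᵇm
  ... | true  = <ᵇ-true j+1<ᵇm
  ... | false = j<m
  next-valid (back j 0F) j<m = j<m
  next-valid (back j 1F) j<m = j<m
  next-valid (back j 2F) j<m = j<m
  next-valid (back j 3F) j<m = j<m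
  next-valid (back j 4F) j<m = j<m
  next-valid (back zero 5F)    _   = z<s
  next-valid (back (suc j) 5F) j<m = <-trans (n<1+n j) j<m

  yOffset<4 : ∀ p → yOffset p < 4
  yOffset<4 (enter _)      = s≤s z≤n
  yOffset<4 (down _ r s)   = <-trans (bit<2 (isOdd r xor s)) (s≤s (s≤s (s≤s z≤n)))
  yOffset<4 (bottom _ 0F)  = s≤s z≤n
  yOffset<4 (bottom _ 1F)  = s≤s z≤n
  yOffset<4 (bottom _ 2F)  = s≤s (s≤s z≤n)
  yOffset<4 (bottom _ 3F)  = s≤s (s≤s z≤n)
  yOffset<4 (bottom _ 4F)  = s≤s (s≤s (s≤s z≤n))
  yOffset<4 (bottom _ 5F)  = s≤s (s≤s (s≤s z≤n))
  yOffset<4 (bottom _ 6F)  = ≤-refl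
  yOffset<4 (bottom _ 7F)  = ≤-refl
  yOffset<4 (up _ r s)     = s≤s (s≤s (bit<2 (not (isOdd r xor s))))
  yOffset<4 (leave _)      = ≤-refl
  yOffset<4 (back _ 0F)    = ≤-refl
  yOffset<4 (back _ 1F)    = s≤s (s≤s (s≤s z≤n))
  yOffset<4 (back _ 2F)    = s≤s (s≤s (s≤s z≤n))
  yOffset<4 (back _ 3F)    = s≤s (s≤s z≤n)
  yOffset<4 (back _ 4F)    = s≤s (s≤s z≤n)
  yOffset<4 (back _ 5F)    = s≤s z≤n

  block<m : ∀ p → Valid p → block p < m
  block<m (enter _)    j<m       = j<m
  block<m (down _ _ _) (j<m , _) = j<m
  block<m (bottom _ _) j<m       = j<m
  block<m (up _ _ _)   (j<m , _) = j<m
  block<m (leave _)    j<m       = j<m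
  block<m (back _ _)   j<m       = j<m

  +*4<n : ∀ {k j} → k < 4 → j < m → k + j * 4 < n
  +*4<n {k} {j} k<4 j<m = <-≤-trans (+-monoˡ-< (j * 4) k<4) (*-monoˡ-≤ 4 j<m)

  y<n : ∀ p → Valid p → yOf p < n
  y<n p v = +*4<n (yOffset<4 p) (block<m p v)

  x<n : ∀ p → Valid p → xOf p < n
  x<n (enter _)    _        = s≤s (s≤s z≤n)
  x<n (down _ r _) (_ , r<L) = +-monoʳ-< 2 (<-trans r<L (m<n+m L (s≤s z≤n)))
  x<n (bottom _ e) _        = +-monoʳ-< 2 (+-monoˡ-< L (depth<2 e))
    where
    depth<2 : ∀ e → bottomDepth e < 2
    depth<2 0F = s≤s z≤n
    depth<2 1F = ≤-refl
    depth<2 2F = ≤-refl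
    depth<2 3F = s≤s z≤n
    depth<2 4F = s≤s z≤n
    depth<2 5F = ≤-refl
    depth<2 6F = ≤-refl
    depth<2 7F = s≤s z≤n
  x<n (up _ r _)   _        = +-monoʳ-< 2 (≤-<-trans (m∸n≤m L (suc r)) (m<n+m L (s≤s z≤n)))
  x<n (leave _)    _        = s≤s (s≤s z≤n)
  x<n (back _ e)   _        = <-≤-trans (s≤s (backX≤1 e)) (s≤s (s≤s z≤n))
    where
    backX≤1 : ∀ e → backX e ≤ 1
    backX≤1 0F = z≤n
    backX≤1 1F = z≤n
    backX≤1 2F = ≤-refl
    backX≤1 3F = ≤-refl
    backX≤1 4F = z≤n
    backX≤1 5F = z≤n

  -- Block j occupies the indices [j * size , (j + 1) * size), followed by the back parts of blocks
  -- m′, m′ ∸ 1, …, 0; the offsets are arranged so that most steps add 1 definitionally.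
  size M N : ℕ
  size = 10 + (L * 2 + L * 2)
  M = m * size
  N = n * n

  enc : Pos → ℕ
  enc (enter j)    = 0 + j * size
  enc (down j r s) = suc (bit s + r * 2) + j * size
  enc (bottom j e) = suc (toℕ e + L * 2) + j * size
  enc (up j r s)   = 9 + (bit s + r * 2 + L * 2) + j * size
  enc (leave j)    = 9 + (L * 2 + L * 2) + j * size
  enc (back j e)   = toℕ e + (m′ ∸ j) * 6 + M

  in-block : ∀ {o j} → j < m → o < size → o + j * size < M
  in-block {o} {j} j<m o<size = <-≤-trans (+-monoˡ-< (j * size) o<size) (*-monoˡ-≤ size j<m)

  zigzag-offset< : ∀ s {r} → r < L → bit s + r * 2 < L * 2
  zigzag-offset< s {r} r<L = <-≤-trans (s≤s (+-monoˡ-≤ (r * 2) (s≤s⁻¹ (bit<2 s)))) (*-monoˡ-≤ 2 r<L)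

  N≡1+enc-last : N ≡ suc (enc (back 0 5F))
  N≡1+enc-last = identity m′
    where
    identity : ∀ k → suc k * 4 * (suc k * 4) ≡ suc (5 + k * 6 + suc k * (10 + (k * 4 * 2 + k * 4 * 2)))
    identity = solve-∀

  enc-next : ∀ p → Valid p → p ≢ back 0 5F → enc (next p) ≡ suc (enc p)
  enc-next (enter j) _ _ with 0 <ᵇ L in 0<ᵇL
  ... | true  = refl
  ... | false = cong (λ l → suc (l * 2) + j * size) (L≡0 0<ᵇL)
  enc-next (down j r false) _ _ = refl
  enc-next (down j r true) (_ , r<L) _ with suc r <ᵇ L in r+1<ᵇL
  ... | true  = refl
  ... | false = cong (λ l → suc (l * 2) + j * size) (sym (last-row r<L r+1<ᵇL))
  enc-next (bottom j 0F) _ _ = refl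
  enc-next (bottom j 1F) _ _ = refl
  enc-next (bottom j 2F) _ _ = refl
  enc-next (bottom j 3F) _ _ = refl
  enc-next (bottom j 4F) _ _ = refl
  enc-next (bottom j 5F) _ _ = refl
  enc-next (bottom j 6F) _ _ = refl
  enc-next (bottom j 7F) _ _ with 0 <ᵇ L in 0<ᵇL
  ... | true  = refl
  ... | false = trans (cong (λ l → 9 + (l * 2 + l * 2) + j * size) (L≡0 0<ᵇL))
                      (cong (λ l → 9 + l * 2 + j * size) (sym (L≡0 0<ᵇL)))
  enc-next (up j r false) _ _ = refl
  enc-next (up j r true) (_ , r<L) _ with suc r <ᵇ L in r+1<ᵇL
  ... | true  = refl
  ... | false = cong (λ l → 9 + (l * 2 + L * 2) + j * size) (sym (last-row r<L r+1<ᵇL))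
  enc-next (leave j) j<m _ with suc j <ᵇ m in j+1<ᵇm
  ... | true  = refl
  ... | false rewrite suc-injective (≤-antisym j<m (<ᵇ-false j+1<ᵇm)) =
    cong (λ k → k * 6 + M) (n∸n≡0 m′)
  enc-next (back j 0F) _ _ = refl
  enc-next (back j 1F) _ _ = refl
  enc-next (back j 2F) _ _ = refl
  enc-next (back j 3F) _ _ = refl
  enc-next (back j 4F) _ _ = refl
  enc-next (back zero 5F)    _   not-last = contradiction refl not-last
  enc-next (back (suc j) 5F) j<m _        = cong (λ k → k * 6 + M) (+-∸-assoc 1 {m′} (s≤s⁻¹ j<m))

  InBlock : Pos → Set
  InBlock (back _ _) = ⊥
  InBlock _          = ⊤

  enc<M : ∀ p → Valid p → InBlock p → enc p < M
  enc<M (enter j)    j<m         _ = in-block j<m (s≤s z≤n)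
  enc<M (down j r s) (j<m , r<L) _ =
    in-block j<m (s≤s (≤-trans (zigzag-offset< s r<L) (≤-trans (m≤m+n (L * 2) (L * 2)) (m≤n+m _ 9))))
  enc<M (bottom j e) j<m         _ =
    in-block j<m (s≤s (s≤s (+-mono-≤ (<⇒≤ (toℕ<n e)) (m≤m+n (L * 2) (L * 2)))))
  enc<M (up j r s)   (j<m , r<L) _ =
    in-block j<m (+-monoʳ-< 9 (≤-trans (+-monoˡ-< (L * 2) (zigzag-offset< s r<L)) (n≤1+n _)))
  enc<M (leave j)    j<m         _ = in-block j<m ≤-refl

  M<N : M < N
  M<N = subst (M <_) (sym N≡1+enc-last) (s≤s (m≤n+m M (5 + m′ * 6)))

  in-block-not-last : ∀ p → Valid p → InBlock p → suc (enc p) ≢ N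
  in-block-not-last p v b last = <⇒≱ (enc<M p v b) (m<1+n⇒m≤n (subst (M <_) (sym last) M<N))

  enc-last : ∀ p → Valid p → suc (enc p) ≡ N → p ≡ back 0 5F
  enc-last (back j e) j<m last = cong₂ back j≡0 (toℕ-injective (proj₁ digits))
    where
    digits : toℕ e ≡ 5 × m′ ∸ j ≡ m′
    digits = +-*-injective 6 (m′ ∸ j) m′ (toℕ<n e) ≤-refl
               (+-cancelʳ-≡ M _ _ (suc-injective (trans last N≡1+enc-last)))
    j≡0 : j ≡ 0
    j≡0 = +-cancelˡ-≡ m′ j 0 (begin
      m′ + j              ≡⟨ cong (_+ j) (proj₂ digits) ⟨
      m′ ∸ j + j          ≡⟨ m∸n+n≡m (s≤s⁻¹ j<m) ⟩
      m′                  ≡⟨ +-identityʳ m′ ⟨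
      m′ + 0              ∎)
      where open ≡-Reasoning
  enc-last (enter j)    v = ⊥-elim ∘ in-block-not-last (enter j) v tt
  enc-last (down j r s) v = ⊥-elim ∘ in-block-not-last (down j r s) v tt
  enc-last (bottom j e) v = ⊥-elim ∘ in-block-not-last (bottom j e) v tt
  enc-last (up j r s)   v = ⊥-elim ∘ in-block-not-last (up j r s) v tt
  enc-last (leave j)    v = ⊥-elim ∘ in-block-not-last (leave j) v tt

  pos : ℕ → Pos
  pos zero    = enter 0
  pos (suc i) = next (pos i)

  pos-valid : ∀ i → Valid (pos i)
  pos-valid zero    = z<s
  pos-valid (suc i) = next-valid (pos i) (pos-valid i)

  enc-pos : ∀ i → i < N → enc (pos i) ≡ i
  enc-pos zero    _     = refl
  enc-pos (suc i) i+1<N = trans (enc-next (pos i) (pos-valid i) not-last) (cong suc enc-i)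
    where
    enc-i : enc (pos i) ≡ i
    enc-i = enc-pos i (<-trans (n<1+n i) i+1<N)
    not-last : pos i ≢ back 0 5F
    not-last pos-i≡last =
      <-irrefl (trans (cong suc (trans (sym enc-i) (cong enc pos-i≡last))) (sym N≡1+enc-last)) i+1<N

  pos-N : pos N ≡ enter 0
  pos-N = begin
    pos N                    ≡⟨ cong pos (suc-pred N) ⟨
    next (pos (pred N))      ≡⟨ cong next (enc-last (pos (pred N)) (pos-valid (pred N)) last) ⟩
    next (back 0 5F)         ≡⟨⟩
    enter 0                  ∎
    where
    open ≡-Reasoning
    last : suc (enc (pos (pred N))) ≡ N
    last = trans (cong suc (enc-pos (pred N) (subst (pred N <_) (suc-pred N) ≤-refl))) (suc-pred N)

  pos-periodic : ∀ i → pos (i + N) ≡ pos i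
  pos-periodic zero    = pos-N
  pos-periodic (suc i) = cong next (pos-periodic i)

  zigzagCell bottomCell : ℕ → ℕ → ℕ → Pos
  zigzagCell r 0 j = down j r (isOdd r)
  zigzagCell r 1 j = down j r (not (isOdd r))
  zigzagCell r 2 j = up j (L ∸ suc r) (not (isOdd (L ∸ suc r)))
  zigzagCell r _ j = up j (L ∸ suc r) (isOdd (L ∸ suc r))
  bottomCell 0 0 j = bottom j 0F
  bottomCell 0 1 j = bottom j 3F
  bottomCell 0 2 j = bottom j 4F
  bottomCell 0 _ j = bottom j 7F
  bottomCell _ 0 j = bottom j 1F
  bottomCell _ 1 j = bottom j 2F
  bottomCell _ 2 j = bottom j 5F
  bottomCell _ _ j = bottom j 6F

  cellPos : ℕ → ℕ → ℕ → Pos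
  cellPos 0 0 j = back j 5F
  cellPos 0 1 j = back j 4F
  cellPos 0 2 j = back j 1F
  cellPos 0 _ j = back j 0F
  cellPos 1 0 j = enter j
  cellPos 1 1 j = back j 3F
  cellPos 1 2 j = back j 2F
  cellPos 1 _ j = leave j
  cellPos (suc (suc r)) k j = if r <ᵇ L then zigzagCell r k j else bottomCell (r ∸ L) k j

  locate : ℕ → ℕ → Pos
  locate x y = cellPos x (y % 4) (y / 4)

  zigzag-down : ∀ r j s → zigzagCell r (bit (isOdd r xor s)) j ≡ down j r s
  zigzag-down r j s with isOdd r in odd-r | s
  ... | true  | true  = cong (down j r) odd-r
  ... | true  | false = cong (down j r ∘ not) odd-r
  ... | false | true  = cong (down j r ∘ not) odd-r
  ... | false | false = cong (down j r) odd-r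

  L∸suc-involutive : ∀ {r} → r < L → L ∸ suc (L ∸ suc r) ≡ r
  L∸suc-involutive r<L = trans (cong (L ∸_) (sym (+-∸-assoc 1 r<L))) (m∸[m∸n]≡n (<⇒≤ r<L))

  zigzag-up : ∀ {r} j s → r < L → zigzagCell (L ∸ suc r) (2 + bit (not (isOdd r xor s))) j ≡ up j r s
  zigzag-up {r} j s r<L with isOdd r in odd-r | s
  ... | true  | true  rewrite L∸suc-involutive r<L = cong (up j r) odd-r
  ... | true  | false rewrite L∸suc-involutive r<L = cong (up j r ∘ not) odd-r
  ... | false | true  rewrite L∸suc-involutive r<L = cong (up j r ∘ not) odd-r
  ... | false | false rewrite L∸suc-involutive r<L = cong (up j r) odd-r

  cellPos-correct : ∀ p → Valid p → cellPos (xOf p) (yOffset p) (block p) ≡ p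
  cellPos-correct (enter j) _ = refl
  cellPos-correct (down j r s) (_ , r<L) rewrite <⇒<ᵇ≡true r<L = zigzag-down r j s
  cellPos-correct (bottom j e) _
    rewrite ≮⇒<ᵇ≡false (≤⇒≯ (m≤n+m L (bottomDepth e))) | m+n∸n≡m (bottomDepth e) L = bottomCell-correct e
    where
    bottomCell-correct : ∀ e → bottomCell (bottomDepth e) ⌊ toℕ e /2⌋ j ≡ bottom j e
    bottomCell-correct 0F = refl
    bottomCell-correct 1F = refl
    bottomCell-correct 2F = refl
    bottomCell-correct 3F = refl
    bottomCell-correct 4F = refl
    bottomCell-correct 5F = refl
    bottomCell-correct 6F = refl
    bottomCell-correct 7F = refl
  cellPos-correct (up j r s) (_ , r<L)
    rewrite <⇒<ᵇ≡true (∸-monoʳ-< {L} {suc r} {0} z<s r<L) = zigzag-up j s r<L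
  cellPos-correct (leave j) _ = refl
  cellPos-correct (back j 0F) _ = refl
  cellPos-correct (back j 1F) _ = refl
  cellPos-correct (back j 2F) _ = refl
  cellPos-correct (back j 3F) _ = refl
  cellPos-correct (back j 4F) _ = refl
  cellPos-correct (back j 5F) _ = refl

  locate-coordinates : ∀ p → Valid p → locate (xOf p) (yOf p) ≡ p
  locate-coordinates p v =
    trans (cong₂ (cellPos (xOf p)) (%-+* 4 (block p) (yOffset<4 p)) (/-+* 4 (block p) (yOffset<4 p)))
          (cellPos-correct p v)

  kind : Pos → Fin 4
  kind (bottom _ 7F) = 1F
  kind (leave _)     = 2F
  kind (back _ 0F)   = 2F
  kind (enter _)     = 3F
  kind (back _ 5F)   = 3F
  kind _             = 0F

  -- The (at most) four positions of block j where the tour goes straight on.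
  straightAt : Fin 4 → ℕ → Pos
  straightAt 0F j       = bottom j 0F
  straightAt 1F j       = bottom j 7F
  straightAt 2F j       = if suc j <ᵇ m then back j 0F else leave j
  straightAt 3F zero    = enter 0
  straightAt 3F (suc j) = back (suc j) 5F

  straight⇒straightAt : ∀ p → Valid p → verticalStep p ≡ verticalStep (next p) →
                        straightAt (kind (next p)) (block (next p)) ≡ next p
  straight⇒straightAt (enter j) _ straight with 0 <ᵇ L
  ... | false = refl
  straight⇒straightAt (down j r true) _ straight with suc r <ᵇ L
  ... | false = refl
  straight⇒straightAt (bottom j 6F) _ _ = refl
  straight⇒straightAt (bottom j 7F) _ straight with 0 <ᵇ L
  ... | false rewrite sym straight = refl
  straight⇒straightAt (up j r true) _ straight with suc r <ᵇ L
  ... | false rewrite sym straight = refl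
  straight⇒straightAt (leave j) _ straight with suc j <ᵇ m
  straight⇒straightAt (leave j) _ () | true
  straight⇒straightAt (leave j) _ () | false
  straight⇒straightAt (back (suc j) 4F) _ _ = refl
  straight⇒straightAt (back zero 5F) _ _ = refl
  straight⇒straightAt (back (suc j) 5F) j+1<m _ rewrite <⇒<ᵇ≡true j+1<m = refl

  cellOf : Pos → Cell n
  cellOf p = fromℕ-mod (xOf p) , fromℕ-mod (yOf p)

  toℕ-x : ∀ p → Valid p → toℕ (proj₁ (cellOf p)) ≡ xOf p
  toℕ-x p v = toℕ-fromℕ-mod (x<n p v)

  toℕ-y : ∀ p → Valid p → toℕ (proj₂ (cellOf p)) ≡ yOf p
  toℕ-y p v = toℕ-fromℕ-mod (y<n p v)

  cellOf-injective : ∀ {p q} → Valid p → Valid q → cellOf p ≡ cellOf q → p ≡ q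
  cellOf-injective {p} {q} vp vq p≡q = begin
    p                       ≡⟨ locate-coordinates p vp ⟨
    locate (xOf p) (yOf p)  ≡⟨ cong₂ locate x-same y-same ⟩
    locate (xOf q) (yOf q)  ≡⟨ locate-coordinates q vq ⟩
    q                       ∎
    where
    open ≡-Reasoning
    x-same : xOf p ≡ xOf q
    x-same = trans (sym (toℕ-x p vp)) (trans (cong (toℕ ∘ proj₁) p≡q) (toℕ-x q vq))
    y-same : yOf p ≡ yOf q
    y-same = trans (sym (toℕ-y p vp)) (trans (cong (toℕ ∘ proj₂) p≡q) (toℕ-y q vq))

  step-distance : ∀ {b x y x′ y′} → Step b x y x′ y′ → ∣ x - x′ ∣ + ∣ y - y′ ∣ ≡ 1
  step-distance {true}  {x} {y}      (refl , inj₁ refl) = cong₂ _+_ (∣n-n∣≡0 x) (∣n-1+n∣≡1 y)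
  step-distance {true}  {x} {y′ = y} (refl , inj₂ refl) =
    cong₂ _+_ (∣n-n∣≡0 x) (trans (∣-∣-comm (suc y) y) (∣n-1+n∣≡1 y))
  step-distance {false} {x} {y}      (refl , inj₁ refl) = cong₂ _+_ (∣n-1+n∣≡1 x) (∣n-n∣≡0 y)
  step-distance {false} {x′ = x} {y} (refl , inj₂ refl) =
    cong₂ _+_ (trans (∣-∣-comm (suc x) x) (∣n-1+n∣≡1 x)) (∣n-n∣≡0 y)

  adjacent-next : ∀ p → Valid p → Adjacent (cellOf p) (cellOf (next p))
  adjacent-next p v
    rewrite toℕ-x p v | toℕ-y p v | toℕ-x (next p) (next-valid p v) | toℕ-y (next p) (next-valid p v) =
    step-distance (step p v)

  vertical?-next : ∀ p → Valid p → vertical? (cellOf p) (cellOf (next p)) ≡ verticalStep p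
  vertical?-next p v with verticalStep p | step p v
  ... | true  | x′≡x , _   = dec-true (fromℕ-mod (xOf p) ≟ᶠ fromℕ-mod (xOf (next p))) (cong fromℕ-mod (sym x′≡x))
  ... | false | _ , x±1 = dec-false (fromℕ-mod (xOf p) ≟ᶠ fromℕ-mod (xOf (next p))) (±1⇒≢ x±1 ∘ x-equal)
    where
    x-equal : fromℕ-mod (xOf p) ≡ fromℕ-mod (xOf (next p)) → xOf p ≡ xOf (next p)
    x-equal e = trans (sym (toℕ-x p v)) (trans (cong toℕ e) (toℕ-x (next p) (next-valid p v)))
    ±1⇒≢ : ∀ {x x′} → x′ ≡ suc x ⊎ x ≡ suc x′ → x ≢ x′
    ±1⇒≢ (inj₁ refl) = 1+n≢n ∘ sym
    ±1⇒≢ (inj₂ refl) = 1+n≢n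

  tour : HamiltonCycle n
  tour = record
    { cell       = cellOf ∘ pos
    ; periodic   = cong cellOf ∘ pos-periodic
    ; adjacent   = λ i → adjacent-next (pos i) (pos-valid i)
    ; injective  = pos-injective
    ; surjective = injective⇒covering (cellOf ∘ pos) pos-injective
    }
    where
    pos-injective : ∀ i j → i < N → j < N → cellOf (pos i) ≡ cellOf (pos j) → i ≡ j
    pos-injective i j i<N j<N same = begin
      i              ≡⟨ enc-pos i i<N ⟨
      enc (pos i)    ≡⟨ cong enc (cellOf-injective (pos-valid i) (pos-valid j) same) ⟩
      enc (pos j)    ≡⟨ enc-pos j j<N ⟩
      j              ∎
      where open ≡-Reasoning

  4≤n : 4 ≤ n
  4≤n = m≤m+n 4 L

  open CycleStructure tour 4≤n using (turnAt; turns≡count-turnAt; cell-unshift)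

  turnAt≡verticalStep-xor : ∀ i → turnAt i ≡ verticalStep (pos i) xor verticalStep (pos (suc i))
  turnAt≡verticalStep-xor i = begin
    turnAt i
      ≡⟨ turn≡vertical?-xor (cellOf p) (cellOf (next p)) (cellOf (next (next p)))
                            (adjacent-next p vp) (adjacent-next (next p) vp′) ⟩
    vertical? (cellOf (next p)) (cellOf p) xor vertical? (cellOf (next p)) (cellOf (next (next p)))
      ≡⟨ cong₂ _xor_ (trans (vertical?-sym (cellOf (next p)) (cellOf p)) (vertical?-next p vp))
                     (vertical?-next (next p) vp′) ⟩
    verticalStep p xor verticalStep (next p) ∎
    where
    open ≡-Reasoning
    open Grid using (turn≡vertical?-xor; vertical?-sym)
    p : Pos
    p = pos i
    vp : Valid p
    vp = pos-valid i
    vp′ : Valid (next p)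
    vp′ = pos-valid (suc i)

  code : ℕ → ℕ
  code i = toℕ (kind (pos (suc i))) + block (pos (suc i)) * 4

  straight-decoded : ∀ i → not (turnAt i) ≡ true → straightAt (kind (pos (suc i))) (block (pos (suc i))) ≡ pos (suc i)
  straight-decoded i straight = straight⇒straightAt (pos i) (pos-valid i)
    (xor≡false (trans (sym (turnAt≡verticalStep-xor i)) (not-true straight)))
    where
    xor≡false : ∀ {a b} → a xor b ≡ false → a ≡ b
    xor≡false {true}  {true}  _ = refl
    xor≡false {false} {false} _ = refl

  straight-index-injective : ∀ i j → i < N → j < N → not (turnAt i) ≡ true → not (turnAt j) ≡ true →
                             code i ≡ code j → i ≡ j
  straight-index-injective i j i<N j<N straight-i straight-j code≡ =
    injective tour i j i<N j<N (cell-unshift {i} {j} (cong cellOf (begin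
      pos (suc i)                                           ≡⟨ straight-decoded i straight-i ⟨
      straightAt (kind (pos (suc i))) (block (pos (suc i))) ≡⟨ cong₂ straightAt (toℕ-injective (proj₁ digits)) (proj₂ digits) ⟩
      straightAt (kind (pos (suc j))) (block (pos (suc j))) ≡⟨ straight-decoded j straight-j ⟩
      pos (suc j)                                           ∎)))
    where
    open ≡-Reasoning
    digits : toℕ (kind (pos (suc i))) ≡ toℕ (kind (pos (suc j))) × block (pos (suc i)) ≡ block (pos (suc j))
    digits = +-*-injective 4 (block (pos (suc i))) (block (pos (suc j)))
                           (toℕ<n (kind (pos (suc i)))) (toℕ<n (kind (pos (suc j)))) code≡

  few-straight : count (not ∘ turnAt) N ≤ n
  few-straight = count≤-by-code N code n
    (λ i _ _ → +*4<n (toℕ<n (kind (pos (suc i)))) (block<m (pos (suc i)) (pos-valid (suc i))))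
    straight-index-injective

  turns-tour : turns tour ≡ n * n ∸ n
  turns-tour = ≤-antisym (UpperBound.turns≤ 4≤n (m * 2) (sym (*-assoc m 2 2)) tour) (begin
    N ∸ n                                        ≤⟨ ∸-monoʳ-≤ N few-straight ⟩
    N ∸ count (not ∘ turnAt) N                   ≡⟨ cong (_∸ count (not ∘ turnAt) N) (count-complement turnAt N) ⟨
    count turnAt N + count (not ∘ turnAt) N ∸ count (not ∘ turnAt) N
                                                 ≡⟨ m+n∸n≡m (count turnAt N) (count (not ∘ turnAt) N) ⟩
    count turnAt N                               ≡⟨ turns≡count-turnAt ⟨
    turns tour                                   ∎)
    where open ≤-Reasoning

claim15 : (n : ℕ) → 0 < n → 4 ∣ n →
    ((H : HamiltonCycle n) → turns H ≤ n * n ∸ n)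
    × (Σ (HamiltonCycle n) λ H → (turns {n} H ≡ n * n ∸ n))
claim15 .(suc m′ * 4) _ (divides (suc m′) refl) =
  UpperBound.turns≤ (Tour.4≤n m′) (suc m′ * 2) (sym (*-assoc (suc m′) 2 2)) , Tour.tour m′ , Tour.turns-tour m′
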